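{- $\mathbf{CLA4}$ proves $\sqcap x\sqcap y\sqcup z\,(x=y+z\ \sqcup\ y=x+z)$.
   Context: Language of $\mathbf{CLA4}$. Terms are built from variables, the constant $0$, unary $'$ (successor), binary $+$, $\times$; atomic formulas are $\tau_1=\tau_2$. Formulas are built from atoms with $\top,\bot$, $\neg$ (officially applied only to atoms; elsewhere via De Morgan laws and double negation), $\wedge,\vee$, choice connectives $\sqcap,\sqcup$, and quantifiers $\forall,\exists$ (blind) and $\sqcap x,\sqcup x$ (choice). $E\to F$ abbreviates $\neg E\vee F$. Elementary formulas are those without $\sqcap,\sqcup$ (formulas of Peano arithmetic $\mathbf{PA}$). $\tau 0$ abbreviates $0''\times\tau$ and $\tau1$ abbreviates $(0''\times\tau)'$. $|x|$ denotes the length $\lceil\log_2(x+1)\rceil$ of the binary numeral of $x$; expressions involving $|x|$ abbreviate standard $\mathbf{PA}$ formulas. A polynomial sizebound for $x$ is a $\mathbf{PA}$ formula expressing $|x|\le\tau(|y_1|,\ldots,|y_n|)$, with the $y_i$ variables other than $x$ and $\tau$ built from $0,',+,\times$. A formula is polynomially bounded iff each subformula $\sqcap xG(x)$ has $G(x)$ of the form $S(x)\to H(x)$ and each subformula $\sqcup xG(x)$ has $G(x)$ of the form $S(x)\wedge H(x)$, $S(x)$ a polynomial sizebound for $x$. The $\sqcap$-closure ($\forall$-closure) prefixes $\sqcap$ ($\forall$) over all free variables. Logic $\mathbf{CL12}$. A sequent is $E_1,\ldots,E_n\circ\!\!-F$. The elementarization $\|F\|$ replaces every $\sqcup$- and $\sqcup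 x$-subformula by $\bot$ and every $\sqcap$- and $\sqcap x$-subformula by $\top$; the elementarization of a sequent is $\|E_1\|\wedge\ldots\wedge\|E_n\|\to\|F\|$; a sequent is stable iff its elementarization is classically valid (first-order logic with identity). A surface occurrence is one not in the scope of a choice operator; $F[E]$ denotes a formula with a fixed surface occurrence of $E$. Rules ($i\in\{0,1\}$; $\mathfrak t$ a constant or a variable not bound in the premise): $\sqcup$-Choose: $\vec G\circ\!\!-F[H_i]\,/\,\vec G\circ\!\!-F[H_0\sqcup H_1]$; $\sqcap$-Choose: $\vec G,E[H_i],\vec K\circ\!\!-F\,/\,\vec G,E[H_0\sqcap H_1],\vec K\circ\!\!-F$; $\sqcup x$-Choose: $\vec G\circ\!\!-F[H(\mathfrak t)]\,/\,\vec G\circ\!\!-F[\sqcup xH(x)]$; $\sqcap x$-Choose: $\vec G,E[H(\mathfrak t)],\vec K\circ\!\!-F\,/\,\vec G,E[\sqcap xH(x)],\vec K\circ\!\!-F$; Replicate: $\vec G,E,\vec K,E\circ\!\!-F\,/\,\vec G,E,\vec K\circ\!\!-F$; Wait: from $Y_1,\ldots,Y_n$ ($n\ge0$) infer a stable $X$ provided: if $X$ is $\vec G\circ\!\!-F[H_0\sqcap H_1]$ then $\vec G\circ\!\!-F[H_0]$, $\vec G\circ\!\!-F[H_1]$ are among the $Y_j$; if $X$ is $\vec G,E[H_0\sqcup H_1],\vec K\circ\!\!-F$ then $\vec G,E[H_0],\vec K\circ\!\!-F$, $\vec G,E[H_1],\vec K\circ\!\!-F$ are among the $Y_j$; if $X$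 is $\vec G\circ\!\!-F[\sqcap xH(x)]$ then $\vec G\circ\!\!-F[H(y)]$ is among the $Y_j$ for some $y$ not in $X$; if $X$ is $\vec G,E[\sqcup xH(x)],\vec K\circ\!\!-F$ then $\vec G,E[H(y)],\vec K\circ\!\!-F$ is among the $Y_j$ for some $y$ not in $X$. System $\mathbf{CLA4}$. Axioms: $\forall x(0\neq x')$; $\forall x\forall y(x'=y'\to x=y)$; $\forall x(x+0=x)$; $\forall x\forall y(x+y'=(x+y)')$; $\forall x(x\times0=0)$; $\forall x\forall y(x\times y'=(x\times y)+x)$; the $\forall$-closure of $F(0)\wedge\forall x(F(x)\to F(x'))\to\forall xF(x)$ for each elementary $F(x)$; $\sqcap x\sqcup y(y=x')$; $\sqcap x\sqcup y(y=x0)$. Rules: Logical Consequence (from sentences $E_1,\ldots,E_n$ infer a sentence $F$ whenever $\mathbf{CL12}$ proves $E_1,\ldots,E_n\circ\!\!-F$), and $\mathbf{CLA4}$-Induction: from the $\sqcap$-closures of $F(0)$, $F(x)\to F(x0)$, $F(x)\to F(x1)$ infer the $\sqcap$-closure of $F(x)$, for polynomially bounded $F(x)$. A sentence is provable in $\mathbf{CLA4}$ iff there is a finite sequence of sentences, each an axiom or obtained from earlier ones by a rule, ending with it. -}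

module Defs where

open import Data.Nat as ℕ using (ℕ; zero; suc; _≤_; _≡ᵇ_)
open import Data.Nat.Logarithm using (⌈log₂_⌉)
open import Data.Bool using (Bool; true; false; _∨_; _∧_; not; if_then_else_)
open import Data.List using (List; []; _∷_; _++_; foldr; upTo)
open import Data.Bool.ListAction using (any)
open import Data.List.Relation.Unary.All using (All)
open import Data.Product using (Σ; _×_; _,_)
open import Data.Sum using (_⊎_)
open import Data.Unit using (⊤)
open import Data.Empty using (⊥)
open import Relation.Nullary using (¬_)
open import Relation.Binary.PropositionalEquality using (_≡_)
open import Function.Bundles using (_⇔_)

Var : Set
Var = ℕ

data Term : Set where
  var : Var → Term
  𝟎   : Term
  _′  : Term → Term
  _⊕_ : Term → Term → Term
  _⊗_ : Term → Term → Term

infixl 8 _′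
infixl 6 _⊕_
infixl 7 _⊗_

-- Formulas in negation normal form: ¬ is officially applied only to atoms.
data Formula : Set where
  Eq Neq     : Term → Term → Formula
  Top Bot    : Formula
  And Or     : Formula → Formula → Formula
  CAnd COr   : Formula → Formula → Formula      -- ⊓ , ⊔
  Forall Exists   : Var → Formula → Formula     -- ∀x , ∃x   (blind)
  CForall CExists : Var → Formula → Formula     -- ⊓x , ⊔x   (choice)

neg : Formula → Formula
neg (Eq a b) = Neq a b
neg (Neq a b) = Eq a b
neg Top = Bot
neg Bot = Top
neg (And A B) = Or (neg A) (neg B)
neg (Or A B) = And (neg A) (neg B)
neg (CAnd A B) = COr (neg A) (neg B)
neg (COr A B) = CAnd (neg A) (neg B)
neg (Forall x A) = Exists x (neg A)
neg (Exists x A) = Forall x (neg A)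
neg (CForall x A) = CExists x (neg A)
neg (CExists x A) = CForall x (neg A)

_⇒_ : Formula → Formula → Formula
E ⇒ F = Or (neg E) F

infixr 4 _⇒_

_·0 : Term → Term
t ·0 = (𝟎 ′ ′) ⊗ t

_·1 : Term → Term
t ·1 = ((𝟎 ′ ′) ⊗ t) ′

isElem : Formula → Bool
isElem (Eq _ _) = true
isElem (Neq _ _) = true
isElem Top = true
isElem Bot = true
isElem (And A B) = isElem A ∧ isElem B
isElem (Or A B) = isElem A ∧ isElem B
isElem (CAnd _ _) = false
isElem (COr _ _) = false
isElem (Forall _ A) = isElem A
isElem (Exists _ A) = isElem A
isElem (CForall _ _) = false
isElem (CExists _ _) = false

Elementary : Formula → Set
Elementary F = isElem F ≡ true

varsT : Term → List Var
varsT (var v) = v ∷ []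
varsT 𝟎 = []
varsT (t ′) = varsT t
varsT (s ⊕ t) = varsT s ++ varsT t
varsT (s ⊗ t) = varsT s ++ varsT t

inT : Var → Term → Bool
inT x t = any (λ v → v ≡ᵇ x) (varsT t)

varsF : Formula → List Var
varsF (Eq a b) = varsT a ++ varsT b
varsF (Neq a b) = varsT a ++ varsT b
varsF Top = []
varsF Bot = []
varsF (And A B) = varsF A ++ varsF B
varsF (Or A B) = varsF A ++ varsF B
varsF (CAnd A B) = varsF A ++ varsF B
varsF (COr A B) = varsF A ++ varsF B
varsF (Forall x A) = x ∷ varsF A
varsF (Exists x A) = x ∷ varsF A
varsF (CForall x A) = x ∷ varsF A
varsF (CExists x A) = x ∷ varsF A

occurs : Var → Formula → Bool
occurs x F = any (λ v → v ≡ᵇ x) (varsF F)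

boundIn : Var → Formula → Bool
boundIn x (Eq _ _) = false
boundIn x (Neq _ _) = false
boundIn x Top = false
boundIn x Bot = false
boundIn x (And A B) = boundIn x A ∨ boundIn x B
boundIn x (Or A B) = boundIn x A ∨ boundIn x B
boundIn x (CAnd A B) = boundIn x A ∨ boundIn x B
boundIn x (COr A B) = boundIn x A ∨ boundIn x B
boundIn x (Forall y A) = (y ≡ᵇ x) ∨ boundIn x A
boundIn x (Exists y A) = (y ≡ᵇ x) ∨ boundIn x A
boundIn x (CForall y A) = (y ≡ᵇ x) ∨ boundIn x A
boundIn x (CExists y A) = (y ≡ᵇ x) ∨ boundIn x A

freeIn : Var → Formula → Bool
freeIn x (Eq a b) = inT x a ∨ inT x b
freeIn x (Neq a b) = inT x a ∨ inT x b
freeIn x Top = false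
freeIn x Bot = false
freeIn x (And A B) = freeIn x A ∨ freeIn x B
freeIn x (Or A B) = freeIn x A ∨ freeIn x B
freeIn x (CAnd A B) = freeIn x A ∨ freeIn x B
freeIn x (COr A B) = freeIn x A ∨ freeIn x B
freeIn x (Forall y A) = not (y ≡ᵇ x) ∧ freeIn x A
freeIn x (Exists y A) = not (y ≡ᵇ x) ∧ freeIn x A
freeIn x (CForall y A) = not (y ≡ᵇ x) ∧ freeIn x A
freeIn x (CExists y A) = not (y ≡ᵇ x) ∧ freeIn x A

Sentence : Formula → Set
Sentence F = (v : Var) → freeIn v F ≡ false

substT : Var → Term → Term → Term
substT x s (var v) = if v ≡ᵇ x then s else var v
substT x s 𝟎 = 𝟎
substT x s (t ′) = substT x s t ′
substT x s (t ⊕ u) = substT x s t ⊕ substT x s u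
substT x s (t ⊗ u) = substT x s t ⊗ substT x s u

subst : Var → Term → Formula → Formula
subst x s (Eq a b) = Eq (substT x s a) (substT x s b)
subst x s (Neq a b) = Neq (substT x s a) (substT x s b)
subst x s Top = Top
subst x s Bot = Bot
subst x s (And A B) = And (subst x s A) (subst x s B)
subst x s (Or A B) = Or (subst x s A) (subst x s B)
subst x s (CAnd A B) = CAnd (subst x s A) (subst x s B)
subst x s (COr A B) = COr (subst x s A) (subst x s B)
subst x s (Forall y A) = if y ≡ᵇ x then Forall y A else Forall y (subst x s A)
subst x s (Exists y A) = if y ≡ᵇ x then Exists y A else Exists y (subst x s A)
subst x s (CForall y A) = if y ≡ᵇ x then CForall y A else CForall y (subst x s A)
subst x s (CExists y A) = if y ≡ᵇ x then CExists y A else CExists y (subst x s A)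

maxVar : Formula → ℕ
maxVar F = foldr ℕ._⊔_ 0 (varsF F)

freeList : Formula → List Var
freeList F = go (upTo (suc (maxVar F)))
  where
  go : List Var → List Var
  go [] = []
  go (v ∷ vs) = if freeIn v F then v ∷ go vs else go vs

⊓closure : Formula → Formula
⊓closure F = foldr CForall F (freeList F)

∀closure : Formula → Formula
∀closure F = foldr Forall F (freeList F)

-- Truth is given by the Gödel–Gentzen negative clauses, so that it is
-- the classical (Tarskian) truth notion read constructively.

record Structure : Set₁ where
  field
    D   : Set
    z   : D
    sc  : D → D
    pl  : D → D → D
    tm  : D → D → D

open Structure public

evalT : (M : Structure) → (Var → D M) → Term → D M
evalT M ρ (var v) = ρ v
evalT M ρ 𝟎 = z M
evalT M ρ (t ′) = sc M (evalT M ρ t)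
evalT M ρ (t ⊕ u) = pl M (evalT M ρ t) (evalT M ρ u)
evalT M ρ (t ⊗ u) = tm M (evalT M ρ t) (evalT M ρ u)

update : {A : Set} → (Var → A) → Var → A → (Var → A)
update ρ x d v = if v ≡ᵇ x then d else ρ v

-- Truth of an elementary formula (choice connectives never occur in the
-- formulas this is applied to: elementarizations are elementary).
Sat : (M : Structure) → (Var → D M) → Formula → Set
Sat M ρ (Eq a b) = ¬ ¬ (evalT M ρ a ≡ evalT M ρ b)
Sat M ρ (Neq a b) = ¬ (evalT M ρ a ≡ evalT M ρ b)
Sat M ρ Top = ⊤
Sat M ρ Bot = ⊥
Sat M ρ (And A B) = Sat M ρ A × Sat M ρ B
Sat M ρ (Or A B) = ¬ (¬ Sat M ρ A × ¬ Sat M ρ B)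
Sat M ρ (CAnd _ _) = ⊥
Sat M ρ (COr _ _) = ⊥
Sat M ρ (Forall x A) = (d : D M) → Sat M (update ρ x d) A
Sat M ρ (Exists x A) = ¬ ((d : D M) → ¬ Sat M (update ρ x d) A)
Sat M ρ (CForall _ _) = ⊥
Sat M ρ (CExists _ _) = ⊥

Valid : Formula → Set₁
Valid F = (M : Structure) (ρ : Var → D M) → Sat M ρ F

record Sequent : Set where
  constructor _∘-_
  field
    ante : List Formula
    succ : Formula

infix 3 _∘-_

‖_‖ : Formula → Formula
‖ Eq a b ‖ = Eq a b
‖ Neq a b ‖ = Neq a b
‖ Top ‖ = Top
‖ Bot ‖ = Bot
‖ And A B ‖ = And ‖ A ‖ ‖ B ‖
‖ Or A B ‖ = Or ‖ A ‖ ‖ B ‖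
‖ CAnd _ _ ‖ = Top
‖ COr _ _ ‖ = Bot
‖ Forall x A ‖ = Forall x ‖ A ‖
‖ Exists x A ‖ = Exists x ‖ A ‖
‖ CForall _ _ ‖ = Top
‖ CExists _ _ ‖ = Bot

conj : List Formula → Formula
conj [] = Top
conj (E ∷ []) = E
conj (E ∷ Es@(_ ∷ _)) = And E (conj Es)

elemSeq : Sequent → Formula
elemSeq (Γ ∘- F) = conj (Data.List.map ‖_‖ Γ) ⇒ ‖ F ‖

Stable : Sequent → Set₁
Stable X = Valid (elemSeq X)

-- surface contexts F[·] : positions not in the scope of a choice operator
data Ctx : Set where
  hole    : Ctx
  andL    : Ctx → Formula → Ctx
  andR    : Formula → Ctx → Ctx
  orL     : Ctx → Formula → Ctx
  orR     : Formula → Ctx → Ctx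
  forallC : Var → Ctx → Ctx
  existsC : Var → Ctx → Ctx

plug : Ctx → Formula → Formula
plug hole E = E
plug (andL C B) E = And (plug C E) B
plug (andR A C) E = And A (plug C E)
plug (orL C B) E = Or (plug C E) B
plug (orR A C) E = Or A (plug C E)
plug (forallC x C) E = Forall x (plug C E)
plug (existsC x C) E = Exists x (plug C E)

occursSeq : Var → Sequent → Bool
occursSeq y (Γ ∘- F) = any (occurs y) Γ ∨ occurs y F

boundSeq : Var → Sequent → Bool
boundSeq y (Γ ∘- F) = any (boundIn y) Γ ∨ boundIn y F

Admissible : Term → Sequent → Set
Admissible t X = (t ≡ 𝟎) ⊎ Σ Var (λ v → (t ≡ var v) × (boundSeq v X ≡ false))

pick : Bool → Formula → Formula → Formula
pick false H₀ H₁ = H₀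
pick true H₀ H₁ = H₁

data CL12 : Sequent → Set₁ where
  ⊔-choose : ∀ Γ C H₀ H₁ (i : Bool)
    → CL12 (Γ ∘- plug C (pick i H₀ H₁))
    → CL12 (Γ ∘- plug C (COr H₀ H₁))
  ⊓-choose : ∀ G K C H₀ H₁ (i : Bool) F
    → CL12 (G ++ plug C (pick i H₀ H₁) ∷ K ∘- F)
    → CL12 (G ++ plug C (CAnd H₀ H₁) ∷ K ∘- F)
  ⊔x-choose : ∀ Γ C x H t
    → Admissible t (Γ ∘- plug C (subst x t H))
    → CL12 (Γ ∘- plug C (subst x t H))
    → CL12 (Γ ∘- plug C (CExists x H))
  ⊓x-choose : ∀ G K C x H t F
    → Admissible t (G ++ plug C (subst x t H) ∷ K ∘- F)
    → CL12 (G ++ plug C (subst x t H) ∷ K ∘- F)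
    → CL12 (G ++ plug C (CForall x H) ∷ K ∘- F)
  replicate : ∀ G E K F
    → CL12 (G ++ E ∷ K ++ E ∷ [] ∘- F)
    → CL12 (G ++ E ∷ K ∘- F)
  wait : ∀ Γ F
    → Stable (Γ ∘- F)
    → (∀ C H₀ H₁ → F ≡ plug C (CAnd H₀ H₁)
         → CL12 (Γ ∘- plug C H₀) × CL12 (Γ ∘- plug C H₁))
    → (∀ G K C H₀ H₁ → Γ ≡ G ++ plug C (COr H₀ H₁) ∷ K
         → CL12 (G ++ plug C H₀ ∷ K ∘- F) × CL12 (G ++ plug C H₁ ∷ K ∘- F))
    → (∀ C x H → F ≡ plug C (CForall x H)
         → Σ Var λ y → (occursSeq y (Γ ∘- F) ≡ false)
                       × CL12 (Γ ∘- plug C (subst x (var y) H)))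
    → (∀ G K C x H → Γ ≡ G ++ plug C (CExists x H) ∷ K
         → Σ Var λ y → (occursSeq y (Γ ∘- F) ≡ false)
                       × CL12 (G ++ plug C (subst x (var y) H) ∷ K ∘- F))
    → CL12 (Γ ∘- F)

ℕStr : Structure
ℕStr = record { D = ℕ ; z = 0 ; sc = suc ; pl = ℕ._+_ ; tm = ℕ._*_ }

∣_∣ : ℕ → ℕ
∣ n ∣ = ⌈log₂ (suc n) ⌉

SizeBound : Var → Formula → Set
SizeBound x S =
  Elementary S ×
  Σ Term λ τ → (inT x τ ≡ false) ×
    ((ρ : Var → ℕ) →
      Sat ℕStr ρ S ⇔ (∣ ρ x ∣ ≤ evalT ℕStr (λ v → ∣ ρ v ∣) τ))

data PolyBounded : Formula → Set where
  pbEq      : ∀ a b → PolyBounded (Eq a b)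
  pbNeq     : ∀ a b → PolyBounded (Neq a b)
  pbTop     : PolyBounded Top
  pbBot     : PolyBounded Bot
  pbAnd     : ∀ {A B} → PolyBounded A → PolyBounded B → PolyBounded (And A B)
  pbOr      : ∀ {A B} → PolyBounded A → PolyBounded B → PolyBounded (Or A B)
  pbCAnd    : ∀ {A B} → PolyBounded A → PolyBounded B → PolyBounded (CAnd A B)
  pbCOr     : ∀ {A B} → PolyBounded A → PolyBounded B → PolyBounded (COr A B)
  pbForall  : ∀ x {A} → PolyBounded A → PolyBounded (Forall x A)
  pbExists  : ∀ x {A} → PolyBounded A → PolyBounded (Exists x A)
  -- ⊓x (S(x) → H(x))   (S is elementary, hence trivially polynomially bounded)
  pbCForall : ∀ x S H → SizeBound x S → PolyBounded H
    → PolyBounded (CForall x (S ⇒ H))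
  pbCExists : ∀ x S H → SizeBound x S → PolyBounded H
    → PolyBounded (CExists x (And S H))

private
  x₀ y₀ : Term
  x₀ = var 0
  y₀ = var 1

data Axiom : Formula → Set where
  ax1 : Axiom (Forall 0 (Neq 𝟎 (x₀ ′)))
  ax2 : Axiom (Forall 0 (Forall 1 (Eq (x₀ ′) (y₀ ′) ⇒ Eq x₀ y₀)))
  ax3 : Axiom (Forall 0 (Eq (x₀ ⊕ 𝟎) x₀))
  ax4 : Axiom (Forall 0 (Forall 1 (Eq (x₀ ⊕ y₀ ′) ((x₀ ⊕ y₀) ′))))
  ax5 : Axiom (Forall 0 (Eq (x₀ ⊗ 𝟎) 𝟎))
  ax6 : Axiom (Forall 0 (Forall 1 (Eq (x₀ ⊗ y₀ ′) ((x₀ ⊗ y₀) ⊕ x₀))))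
  ax7 : ∀ F x → Elementary F →
        Axiom (∀closure
          (And (subst x 𝟎 F) (Forall x (F ⇒ subst x (var x ′) F))
            ⇒ Forall x F))
  ax8 : Axiom (CForall 0 (CExists 1 (Eq y₀ (x₀ ′))))
  ax9 : Axiom (CForall 0 (CExists 1 (Eq y₀ (x₀ ·0))))

data Provable : Formula → Set₁ where
  axiom : ∀ {F} → Axiom F → Provable F
  lc : ∀ (Es : List Formula) F
     → All Provable Es → Sentence F → CL12 (Es ∘- F)
     → Provable F
  induction : ∀ F x → PolyBounded F
     → Provable (⊓closure (subst x 𝟎 F))
     → Provable (⊓closure (F ⇒ subst x (var x ·0) F))
     → Provable (⊓closure (F ⇒ subst x (var x ·1) F))
     → Provable (⊓closure F)

module Submission where

-- Three CLA4-inductions on the binary notation of x, with polynomial sizebounds on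
-- the answers, give strategies for halving (⊓x⊔y (x = y0 ⊔ x = y1)), for the predecessor, and
-- for comparison: for a parameter p, ⊓v (|v| ≤ |p| → ⊔z (x = v + z ⊔ v = x + z + 1)). In the
-- comparison step for x0 or x1 we halve v into w (or w + 1), ask the induction hypothesis about
-- it, and double its answer z, adding 1 where needed; the doublings and successors are obtained
-- from the axioms ⊓x⊔y (y = x0) and ⊓x⊔y (y = x′). Taking p = v = y yields the theorem. Sizes
-- are expressed in PA through powers of two (no odd factor but 1), and every leaf of the CL12
-- derivations is checked semantically, in any model of the additive laws, which are themselves
-- proved by elementary induction.

open import Defs
open import Data.Nat as ℕ using (ℕ; zero; suc; _+_; _*_; _^_; _≤_; _<_; z≤n; s≤s; _≤?_; _<?_; _∸_; _≡ᵇ_; _≤ᵇ_)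
import Data.Nat.Properties as ℕₚ
open import Data.Nat.Logarithm using (⌈log₂_⌉; ⌈log₂⌉-mono-≤; ⌈log₂⌈n/2⌉⌉≡⌈log₂n⌉∸1; ⌈log₂2^n⌉≡n)
open import Data.Nat.Induction using (<-rec)
open import Data.Nat.Tactic.RingSolver using (solve-∀)
open import Data.Bool using (Bool; true; false; _∧_; _∨_; if_then_else_)
open import Data.Bool.ListAction using (any)
open import Data.List using (List; []; _∷_; _++_; map; foldr)
open import Data.List.Properties using (∷-injective)
open import Data.List.Relation.Unary.All using (All; []; _∷_)
open import Data.Maybe using (Maybe; just; nothing)
open import Data.Product using (Σ; _×_; _,_; proj₁; proj₂)
open import Data.Sum using (_⊎_; inj₁; inj₂)
open import Data.Unit using (⊤; tt)
open import Data.Empty using (⊥; ⊥-elim)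
open import Relation.Nullary using (¬_; yes; no)
open import Relation.Nullary.Decidable using (decidable-stable)
open import Relation.Binary.PropositionalEquality using (_≡_; _≢_; refl; sym; trans; cong; cong₂; module ≡-Reasoning)
  renaming (subst to transport; subst₂ to transport₂)
open import Function using (_$_)
open import Function.Bundles using (mk⇔)
open import Level using (0ℓ)
open import Relation.Binary.Bundles using (Setoid)
import Relation.Binary.Reasoning.Setoid

-- Elementary formulas under the negative translation

∧-trueˡ : ∀ {a b} → a ∧ b ≡ true → a ≡ true
∧-trueˡ {true} _ = refl

∧-trueʳ : ∀ {a b} → a ∧ b ≡ true → b ≡ true
∧-trueʳ {true} e = e

∧-true : ∀ {a b} → a ≡ true → b ≡ true → a ∧ b ≡ true
∧-true refl e = e

module _ (M : Structure) where

  mutual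
    sat-by-¬neg : ∀ A ρ → Elementary A → ¬ Sat M ρ (neg A) → Sat M ρ A
    sat-by-¬neg (Eq a b) ρ e h = h
    sat-by-¬neg (Neq a b) ρ e h = λ x → h (λ k → k x)
    sat-by-¬neg Top ρ e h = tt
    sat-by-¬neg Bot ρ e h = h tt
    sat-by-¬neg (And A B) ρ e h =
      sat-by-¬neg A ρ (∧-trueˡ e) (λ a → h (λ (na , _) → na a)) ,
      sat-by-¬neg B ρ (∧-trueʳ {isElem A} e) (λ b → h (λ (_ , nb) → nb b))
    sat-by-¬neg (Or A B) ρ e h (na , nb) =
      h (neg-by-¬sat A ρ (∧-trueˡ e) na , neg-by-¬sat B ρ (∧-trueʳ {isElem A} e) nb)
    sat-by-¬neg (Forall x A) ρ e h d = sat-by-¬neg A _ e (λ a → h (λ f → f d a))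
    sat-by-¬neg (Exists x A) ρ e h f = h (λ d → neg-by-¬sat A _ e (f d))

    neg-by-¬sat : ∀ A ρ → Elementary A → ¬ Sat M ρ A → Sat M ρ (neg A)
    neg-by-¬sat (Eq a b) ρ e h = λ x → h (λ k → k x)
    neg-by-¬sat (Neq a b) ρ e h = λ k → h k
    neg-by-¬sat Top ρ e h = h tt
    neg-by-¬sat Bot ρ e h = tt
    neg-by-¬sat (And A B) ρ e h (na , nb) =
      h (sat-by-¬neg A ρ (∧-trueˡ e) na , sat-by-¬neg B ρ (∧-trueʳ {isElem A} e) nb)
    neg-by-¬sat (Or A B) ρ e h =
      neg-by-¬sat A ρ (∧-trueˡ e) (λ a → h (λ (na , _) → na a)) ,
      neg-by-¬sat B ρ (∧-trueʳ {isElem A} e) (λ b → h (λ (_ , nb) → nb b))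
    neg-by-¬sat (Forall x A) ρ e h f = h (λ d → sat-by-¬neg A _ e (f d))
    neg-by-¬sat (Exists x A) ρ e h d = neg-by-¬sat A _ e (λ a → h (λ f → f d a))

  sat-neg-⊥ : ∀ A ρ → Elementary A → Sat M ρ A → Sat M ρ (neg A) → ⊥
  sat-neg-⊥ (Eq a b) ρ e s n = s n
  sat-neg-⊥ (Neq a b) ρ e s n = n s
  sat-neg-⊥ Top ρ e s n = n
  sat-neg-⊥ Bot ρ e s n = s
  sat-neg-⊥ (And A B) ρ e (sa , sb) n =
    n (sat-neg-⊥ A ρ (∧-trueˡ e) sa , sat-neg-⊥ B ρ (∧-trueʳ {isElem A} e) sb)
  sat-neg-⊥ (Or A B) ρ e s (na , nb) =
    s ((λ a → sat-neg-⊥ A ρ (∧-trueˡ e) a na) , (λ b → sat-neg-⊥ B ρ (∧-trueʳ {isElem A} e) b nb))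
  sat-neg-⊥ (Forall x A) ρ e f n = n (λ d → sat-neg-⊥ A _ e (f d))
  sat-neg-⊥ (Exists x A) ρ e s f = s (λ d a → sat-neg-⊥ A _ e a (f d))

  sat-¬¬ : ∀ A ρ → Elementary A → ¬ ¬ Sat M ρ A → Sat M ρ A
  sat-¬¬ A ρ e h = sat-by-¬neg A ρ e (λ n → h (λ a → sat-neg-⊥ A ρ e a n))

  ⇒-intro : ∀ ρ A B → Elementary A → (Sat M ρ A → ¬ ¬ Sat M ρ B) → Sat M ρ (A ⇒ B)
  ⇒-intro ρ A B e h (nna , nb) = h (sat-by-¬neg A ρ e nna) nb

  ⇒-elim : ∀ ρ A B → Elementary A → Sat M ρ (A ⇒ B) → Sat M ρ A → ¬ ¬ Sat M ρ B
  ⇒-elim ρ A B e h a nb = h (sat-neg-⊥ A ρ e a , nb)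

  ∨-introʳ : ∀ ρ A B → Sat M ρ B → Sat M ρ (Or A B)
  ∨-introʳ ρ A B b (_ , nb) = nb b

‖‖-elementary : ∀ F → Elementary ‖ F ‖
‖‖-elementary (Eq a b) = refl
‖‖-elementary (Neq a b) = refl
‖‖-elementary Top = refl
‖‖-elementary Bot = refl
‖‖-elementary (And A B) = ∧-true (‖‖-elementary A) (‖‖-elementary B)
‖‖-elementary (Or A B) = ∧-true (‖‖-elementary A) (‖‖-elementary B)
‖‖-elementary (CAnd A B) = refl
‖‖-elementary (COr A B) = refl
‖‖-elementary (Forall x A) = ‖‖-elementary A
‖‖-elementary (Exists x A) = ‖‖-elementary A
‖‖-elementary (CForall x A) = refl
‖‖-elementary (CExists x A) = refl

SatAnte : (M : Structure) → (Var → D M) → List Formula → Set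
SatAnte M ρ Γ = Sat M ρ (conj (map ‖_‖ Γ))

conj-elementary : ∀ Γ → Elementary (conj (map ‖_‖ Γ))
conj-elementary [] = refl
conj-elementary (E ∷ []) = ‖‖-elementary E
conj-elementary (E ∷ Γ@(_ ∷ _)) = ∧-true (‖‖-elementary E) (conj-elementary Γ)

SatAnte-member : ∀ M ρ G E K → SatAnte M ρ (G ++ E ∷ K) → Sat M ρ ‖ E ‖
SatAnte-member M ρ [] E [] s = s
SatAnte-member M ρ [] E (_ ∷ _) (s , _) = s
SatAnte-member M ρ (_ ∷ []) E K (_ , s) = SatAnte-member M ρ [] E K s
SatAnte-member M ρ (_ ∷ G@(_ ∷ _)) E K (_ , s) = SatAnte-member M ρ G E K s

-- Validity of the elementarization of Γ ∘- F; a record, so that Γ and F are inferred from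
-- the rule it is passed to.
record Entails (Γ : List Formula) (F : Formula) : Set₁ where
  constructor entails
  field holds : ∀ M ρ → SatAnte M ρ Γ → ¬ ¬ Sat M ρ ‖ F ‖

stable : ∀ Γ F → Entails Γ F → Stable (Γ ∘- F)
stable Γ F (entails h) M ρ (nΓ , nF) = h M ρ (sat-by-¬neg M (conj (map ‖_‖ Γ)) ρ (conj-elementary Γ) nΓ) nF

entails-∨ʳ : ∀ {Γ L R} → (∀ M ρ → SatAnte M ρ Γ → Sat M ρ ‖ R ‖) → Entails Γ (Or L R)
entails-∨ʳ h = entails λ M ρ s k → k (λ (_ , nR) → nR (h M ρ s))

entails-⊓x : ∀ {Γ x H} → Entails Γ (CForall x H)
entails-⊓x = entails λ M ρ _ k → k tt

entails-⊥-ante : ∀ G E K F → ‖ E ‖ ≡ Bot → Entails (G ++ E ∷ K) F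
entails-⊥-ante G E K F e = entails λ M ρ s → ⊥-elim (transport (Sat M ρ) e (SatAnte-member M ρ G E K s))

-- Sequents with at most one surface choice occurrence

data Kind : Set where
  ⊓k ⊔k ⊓xk ⊔xk : Kind

data IsChoice : Kind → Formula → Set where
  ⊓c  : ∀ {A B} → IsChoice ⊓k (CAnd A B)
  ⊔c  : ∀ {A B} → IsChoice ⊔k (COr A B)
  ⊓xc : ∀ {x A} → IsChoice ⊓xk (CForall x A)
  ⊔xc : ∀ {x A} → IsChoice ⊔xk (CExists x A)

surface : Kind → Formula → ℕ
surface k (And A B) = surface k A + surface k B
surface k (Or A B) = surface k A + surface k B
surface k (Forall _ A) = surface k A
surface k (Exists _ A) = surface k A
surface ⊓k (CAnd _ _) = 1
surface ⊔k (COr _ _) = 1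
surface ⊓xk (CForall _ _) = 1
surface ⊔xk (CExists _ _) = 1
surface _ _ = 0

surfaceᶜ : Kind → Ctx → ℕ
surfaceᶜ k hole = 0
surfaceᶜ k (andL C B) = surfaceᶜ k C + surface k B
surfaceᶜ k (andR A C) = surface k A + surfaceᶜ k C
surfaceᶜ k (orL C B) = surfaceᶜ k C + surface k B
surfaceᶜ k (orR A C) = surface k A + surfaceᶜ k C
surfaceᶜ k (forallC x C) = surfaceᶜ k C
surfaceᶜ k (existsC x C) = surfaceᶜ k C

surfaceˡ : Kind → List Formula → ℕ
surfaceˡ k [] = 0
surfaceˡ k (F ∷ Fs) = surface k F + surfaceˡ k Fs

surface-plug : ∀ {k E} C → IsChoice k E → surface k (plug C E) ≡ suc (surfaceᶜ k C)
surface-plug hole ⊓c = refl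
surface-plug hole ⊔c = refl
surface-plug hole ⊓xc = refl
surface-plug hole ⊔xc = refl
surface-plug (andL C B) i = cong (_+ _) (surface-plug C i)
surface-plug {k} (andR A C) i = trans (cong (surface k A +_) (surface-plug C i)) (ℕₚ.+-suc _ _)
surface-plug (orL C B) i = cong (_+ _) (surface-plug C i)
surface-plug {k} (orR A C) i = trans (cong (surface k A +_) (surface-plug C i)) (ℕₚ.+-suc _ _)
surface-plug (forallC x C) i = surface-plug C i
surface-plug (existsC x C) i = surface-plug C i

surfaceˡ-plug : ∀ {k E} G C K → IsChoice k E → Σ ℕ λ n → surfaceˡ k (G ++ plug C E ∷ K) ≡ suc n
surfaceˡ-plug [] C K i = _ , cong (_+ _) (surface-plug C i)
surfaceˡ-plug {k} (F ∷ G) C K i with surfaceˡ-plug G C K i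
... | n , e = surface k F + n , trans (cong (surface k F +_) e) (ℕₚ.+-suc _ n)


compound : Formula → Bool
compound (And _ _) = true
compound (Or _ _) = true
compound (Forall _ _) = true
compound (Exists _ _) = true
compound _ = false

choice-not-compound : ∀ {k E} → IsChoice k E → compound E ≢ true
choice-not-compound ⊓c ()
choice-not-compound ⊔c ()
choice-not-compound ⊓xc ()
choice-not-compound ⊔xc ()

And-injective : ∀ {A B A′ B′} → And A B ≡ And A′ B′ → A ≡ A′ × B ≡ B′
And-injective refl = refl , refl

Or-injective : ∀ {A B A′ B′} → Or A B ≡ Or A′ B′ → A ≡ A′ × B ≡ B′
Or-injective refl = refl , refl

Forall-injective : ∀ {x A y B} → Forall x A ≡ Forall y B → x ≡ y × A ≡ B
Forall-injective refl = refl , refl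

Exists-injective : ∀ {x A y B} → Exists x A ≡ Exists y B → x ≡ y × A ≡ B
Exists-injective refl = refl , refl

plug-≢0 : ∀ {k E} C → IsChoice k E → surface k (plug C E) ≢ 0
plug-≢0 C i e with trans (sym (surface-plug C i)) e
... | ()

plug-unique : ∀ {k E₁ E₂} C₁ C₂ → IsChoice k E₁ → IsChoice k E₂ →
              plug C₁ E₁ ≡ plug C₂ E₂ → surfaceᶜ k C₁ ≡ 0 → C₁ ≡ C₂ × E₁ ≡ E₂
plug-unique hole hole _ _ eq _ = refl , eq
plug-unique hole (andL _ _) i _ eq _ = ⊥-elim (choice-not-compound i (cong compound eq))
plug-unique hole (andR _ _) i _ eq _ = ⊥-elim (choice-not-compound i (cong compound eq))
plug-unique hole (orL _ _) i _ eq _ = ⊥-elim (choice-not-compound i (cong compound eq))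
plug-unique hole (orR _ _) i _ eq _ = ⊥-elim (choice-not-compound i (cong compound eq))
plug-unique hole (forallC _ _) i _ eq _ = ⊥-elim (choice-not-compound i (cong compound eq))
plug-unique hole (existsC _ _) i _ eq _ = ⊥-elim (choice-not-compound i (cong compound eq))
plug-unique (andL _ _) hole _ i eq _ = ⊥-elim (choice-not-compound i (cong compound (sym eq)))
plug-unique (andR _ _) hole _ i eq _ = ⊥-elim (choice-not-compound i (cong compound (sym eq)))
plug-unique (orL _ _) hole _ i eq _ = ⊥-elim (choice-not-compound i (cong compound (sym eq)))
plug-unique (orR _ _) hole _ i eq _ = ⊥-elim (choice-not-compound i (cong compound (sym eq)))
plug-unique (forallC _ _) hole _ i eq _ = ⊥-elim (choice-not-compound i (cong compound (sym eq)))
plug-unique (existsC _ _) hole _ i eq _ = ⊥-elim (choice-not-compound i (cong compound (sym eq)))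
plug-unique {k} (andL C₁ B) (andL C₂ _) i₁ i₂ eq z
  with plug-unique C₁ C₂ i₁ i₂ (proj₁ (And-injective eq)) (ℕₚ.m+n≡0⇒m≡0 (surfaceᶜ k C₁) z)
... | refl , refl = cong (andL C₁) (proj₂ (And-injective eq)) , refl
plug-unique {k} (andR A C₁) (andR _ C₂) i₁ i₂ eq z
  with plug-unique C₁ C₂ i₁ i₂ (proj₂ (And-injective eq)) (ℕₚ.m+n≡0⇒n≡0 (surface k A) z)
... | refl , refl = cong (λ A′ → andR A′ C₁) (proj₁ (And-injective eq)) , refl
plug-unique {k} (orL C₁ B) (orL C₂ _) i₁ i₂ eq z
  with plug-unique C₁ C₂ i₁ i₂ (proj₁ (Or-injective eq)) (ℕₚ.m+n≡0⇒m≡0 (surfaceᶜ k C₁) z)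
... | refl , refl = cong (orL C₁) (proj₂ (Or-injective eq)) , refl
plug-unique {k} (orR A C₁) (orR _ C₂) i₁ i₂ eq z
  with plug-unique C₁ C₂ i₁ i₂ (proj₂ (Or-injective eq)) (ℕₚ.m+n≡0⇒n≡0 (surface k A) z)
... | refl , refl = cong (λ A′ → orR A′ C₁) (proj₁ (Or-injective eq)) , refl
plug-unique (forallC x C₁) (forallC _ C₂) i₁ i₂ eq z
  with Forall-injective eq
... | refl , eq′ with plug-unique C₁ C₂ i₁ i₂ eq′ z
... | refl , refl = refl , refl
plug-unique (existsC x C₁) (existsC _ C₂) i₁ i₂ eq z
  with Exists-injective eq
... | refl , eq′ with plug-unique C₁ C₂ i₁ i₂ eq′ z
... | refl , refl = refl , refl
plug-unique {k} (andL C₁ B) (andR _ C₂) _ i₂ eq z =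
  ⊥-elim (plug-≢0 C₂ i₂ (trans (cong (surface k) (sym (proj₂ (And-injective eq))))
                               (ℕₚ.m+n≡0⇒n≡0 (surfaceᶜ k C₁) z)))
plug-unique {k} (andR A C₁) (andL C₂ _) _ i₂ eq z =
  ⊥-elim (plug-≢0 C₂ i₂ (trans (cong (surface k) (sym (proj₁ (And-injective eq))))
                               (ℕₚ.m+n≡0⇒m≡0 (surface k A) z)))
plug-unique {k} (orL C₁ B) (orR _ C₂) _ i₂ eq z =
  ⊥-elim (plug-≢0 C₂ i₂ (trans (cong (surface k) (sym (proj₂ (Or-injective eq))))
                               (ℕₚ.m+n≡0⇒n≡0 (surfaceᶜ k C₁) z)))
plug-unique {k} (orR A C₁) (orL C₂ _) _ i₂ eq z =
  ⊥-elim (plug-≢0 C₂ i₂ (trans (cong (surface k) (sym (proj₁ (Or-injective eq))))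
                               (ℕₚ.m+n≡0⇒m≡0 (surface k A) z)))
plug-unique (andL _ _) (orL _ _) _ _ () _
plug-unique (andL _ _) (orR _ _) _ _ () _
plug-unique (andL _ _) (forallC _ _) _ _ () _
plug-unique (andL _ _) (existsC _ _) _ _ () _
plug-unique (andR _ _) (orL _ _) _ _ () _
plug-unique (andR _ _) (orR _ _) _ _ () _
plug-unique (andR _ _) (forallC _ _) _ _ () _
plug-unique (andR _ _) (existsC _ _) _ _ () _
plug-unique (orL _ _) (andL _ _) _ _ () _
plug-unique (orL _ _) (andR _ _) _ _ () _
plug-unique (orL _ _) (forallC _ _) _ _ () _
plug-unique (orL _ _) (existsC _ _) _ _ () _
plug-unique (orR _ _) (andL _ _) _ _ () _
plug-unique (orR _ _) (andR _ _) _ _ () _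
plug-unique (orR _ _) (forallC _ _) _ _ () _
plug-unique (orR _ _) (existsC _ _) _ _ () _
plug-unique (forallC _ _) (andL _ _) _ _ () _
plug-unique (forallC _ _) (andR _ _) _ _ () _
plug-unique (forallC _ _) (orL _ _) _ _ () _
plug-unique (forallC _ _) (orR _ _) _ _ () _
plug-unique (forallC _ _) (existsC _ _) _ _ () _
plug-unique (existsC _ _) (andL _ _) _ _ () _
plug-unique (existsC _ _) (andR _ _) _ _ () _
plug-unique (existsC _ _) (orL _ _) _ _ () _
plug-unique (existsC _ _) (orR _ _) _ _ () _
plug-unique (existsC _ _) (forallC _ _) _ _ () _

suc+suc≢1 : ∀ m n → suc m + suc n ≢ 1
suc+suc≢1 m n e with ℕₚ.m+n≡0⇒n≡0 m (ℕₚ.suc-injective e)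
... | ()

+≡1⇒≡1 : ∀ m {n} → n ≢ 0 → m + n ≡ 1 → n ≡ 1
+≡1⇒≡1 zero n≢0 e = e
+≡1⇒≡1 (suc m) n≢0 e = ⊥-elim (n≢0 (ℕₚ.m+n≡0⇒n≡0 m (ℕₚ.suc-injective e)))

plug-uniqueˡ : ∀ {k E₁ E₂} G₁ K₁ C₁ G₂ K₂ C₂ → IsChoice k E₁ → IsChoice k E₂ →
               G₁ ++ plug C₁ E₁ ∷ K₁ ≡ G₂ ++ plug C₂ E₂ ∷ K₂ →
               surfaceˡ k (G₁ ++ plug C₁ E₁ ∷ K₁) ≡ 1 →
               G₁ ≡ G₂ × K₁ ≡ K₂ × C₁ ≡ C₂ × E₁ ≡ E₂
plug-uniqueˡ {k} [] K₁ C₁ [] K₂ C₂ i₁ i₂ eq one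
  with ∷-injective eq
... | eqₕ , refl with plug-unique C₁ C₂ i₁ i₂ eqₕ
       (ℕₚ.m+n≡0⇒m≡0 (surfaceᶜ k C₁)
         (ℕₚ.suc-injective (trans (cong (_+ surfaceˡ k K₁) (sym (surface-plug C₁ i₁))) one)))
... | refl , refl = refl , refl , refl , refl
plug-uniqueˡ {k} [] K₁ C₁ (_ ∷ G₂) K₂ C₂ i₁ i₂ eq one
  with surfaceˡ-plug G₂ C₂ K₂ i₂
... | n , e rewrite surface-plug C₁ i₁ | proj₂ (∷-injective eq) | e =
  ⊥-elim (suc+suc≢1 (surfaceᶜ k C₁) n one)
plug-uniqueˡ {k} (_ ∷ G₁) K₁ C₁ [] K₂ C₂ i₁ i₂ eq one
  with surfaceˡ-plug G₁ C₁ K₁ i₁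
... | n , e rewrite proj₁ (∷-injective eq) | surface-plug C₂ i₂ | e =
  ⊥-elim (suc+suc≢1 (surfaceᶜ k C₂) n one)
plug-uniqueˡ {k} (F ∷ G₁) K₁ C₁ (_ ∷ G₂) K₂ C₂ i₁ i₂ eq one
  with ∷-injective eq | surfaceˡ-plug G₁ C₁ K₁ i₁
... | refl , eqₜ | n , e
  with plug-uniqueˡ G₁ K₁ C₁ G₂ K₂ C₂ i₁ i₂ eqₜ
         (+≡1⇒≡1 (surface k F) (λ e₀ → ℕₚ.1+n≢0 (trans (sym e) e₀)) one)
... | refl , refl , refl , refl = refl , refl , refl , refl

-- The obligations of the wait rule: surface ⊓ and ⊓x in the succedent, ⊔ and ⊔x in the antecedent.
profile : Sequent → ℕ × ℕ × ℕ × ℕ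
profile (Γ ∘- F) = surface ⊓k F , surface ⊓xk F , surfaceˡ ⊔k Γ , surfaceˡ ⊔xk Γ

module _ Γ F {a b c d} (p : profile (Γ ∘- F) ≡ (a , b , c , d)) where
  #⊓ : surface ⊓k F ≡ a
  #⊓ = cong proj₁ p
  #⊓x : surface ⊓xk F ≡ b
  #⊓x = cong (λ q → proj₁ (proj₂ q)) p
  #⊔ : surfaceˡ ⊔k Γ ≡ c
  #⊔ = cong (λ q → proj₁ (proj₂ (proj₂ q))) p
  #⊔x : surfaceˡ ⊔xk Γ ≡ d
  #⊔x = cong (λ q → proj₂ (proj₂ (proj₂ q))) p

Wait-⊓ Wait-⊔ Wait-⊓x Wait-⊔x : List Formula → Formula → Set₁
Wait-⊓ Γ F = ∀ C H₀ H₁ → F ≡ plug C (CAnd H₀ H₁) →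
  CL12 (Γ ∘- plug C H₀) × CL12 (Γ ∘- plug C H₁)
Wait-⊔ Γ F = ∀ G K C H₀ H₁ → Γ ≡ G ++ plug C (COr H₀ H₁) ∷ K →
  CL12 (G ++ plug C H₀ ∷ K ∘- F) × CL12 (G ++ plug C H₁ ∷ K ∘- F)
Wait-⊓x Γ F = ∀ C x H → F ≡ plug C (CForall x H) →
  Σ Var λ y → (occursSeq y (Γ ∘- F) ≡ false) × CL12 (Γ ∘- plug C (subst x (var y) H))
Wait-⊔x Γ F = ∀ G K C x H → Γ ≡ G ++ plug C (CExists x H) ∷ K →
  Σ Var λ y → (occursSeq y (Γ ∘- F) ≡ false) × CL12 (G ++ plug C (subst x (var y) H) ∷ K ∘- F)

private
  plug-count : ∀ {k E F} C → IsChoice k E → F ≡ plug C E → surface k F ≡ 0 → ⊥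
  plug-count C i refl z = plug-≢0 C i z

  plugˡ-count : ∀ {k E Γ} G C K → IsChoice k E → Γ ≡ G ++ plug C E ∷ K → surfaceˡ k Γ ≡ 0 → ⊥
  plugˡ-count G C K i refl z with surfaceˡ-plug G C K i
  ... | _ , e = ℕₚ.1+n≢0 (trans (sym e) z)

  plug-count₁ : ∀ {k E} C → IsChoice k E → surface k (plug C E) ≡ 1 → surfaceᶜ k C ≡ 0
  plug-count₁ C i e = ℕₚ.suc-injective (trans (sym (surface-plug C i)) e)

  wait-⊓-none : ∀ Γ F → surface ⊓k F ≡ 0 → Wait-⊓ Γ F
  wait-⊓-none Γ F z C _ _ eq = ⊥-elim (plug-count C ⊓c eq z)

  wait-⊓x-none : ∀ Γ F → surface ⊓xk F ≡ 0 → Wait-⊓x Γ F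
  wait-⊓x-none Γ F z C _ _ eq = ⊥-elim (plug-count C ⊓xc eq z)

  wait-⊔-none : ∀ Γ F → surfaceˡ ⊔k Γ ≡ 0 → Wait-⊔ Γ F
  wait-⊔-none Γ F z G K C _ _ eq = ⊥-elim (plugˡ-count G C K ⊔c eq z)

  wait-⊔x-none : ∀ Γ F → surfaceˡ ⊔xk Γ ≡ 0 → Wait-⊔x Γ F
  wait-⊔x-none Γ F z G K C _ _ eq = ⊥-elim (plugˡ-count G C K ⊔xc eq z)

  wait-⊓-one : ∀ Γ C H₀ H₁ → surface ⊓k (plug C (CAnd H₀ H₁)) ≡ 1 →
    CL12 (Γ ∘- plug C H₀) → CL12 (Γ ∘- plug C H₁) → Wait-⊓ Γ (plug C (CAnd H₀ H₁))
  wait-⊓-one Γ C H₀ H₁ one d₀ d₁ C′ _ _ eq with plug-unique C C′ ⊓c ⊓c eq (plug-count₁ C ⊓c one)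
  ... | refl , refl = d₀ , d₁

  wait-⊓x-one : ∀ Γ C x H y → surface ⊓xk (plug C (CForall x H)) ≡ 1 →
    occursSeq y (Γ ∘- plug C (CForall x H)) ≡ false →
    CL12 (Γ ∘- plug C (subst x (var y) H)) → Wait-⊓x Γ (plug C (CForall x H))
  wait-⊓x-one Γ C x H y one fresh d C′ _ _ eq with plug-unique C C′ ⊓xc ⊓xc eq (plug-count₁ C ⊓xc one)
  ... | refl , refl = y , fresh , d

  wait-⊔-one : ∀ G K C H₀ H₁ F → surfaceˡ ⊔k (G ++ plug C (COr H₀ H₁) ∷ K) ≡ 1 →
    CL12 (G ++ plug C H₀ ∷ K ∘- F) → CL12 (G ++ plug C H₁ ∷ K ∘- F) →
    Wait-⊔ (G ++ plug C (COr H₀ H₁) ∷ K) F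
  wait-⊔-one G K C H₀ H₁ F one d₀ d₁ G′ K′ C′ _ _ eq with plug-uniqueˡ G K C G′ K′ C′ ⊔c ⊔c eq one
  ... | refl , refl , refl , refl = d₀ , d₁

  wait-⊔x-one : ∀ G K C x H F y → surfaceˡ ⊔xk (G ++ plug C (CExists x H) ∷ K) ≡ 1 →
    occursSeq y (G ++ plug C (CExists x H) ∷ K ∘- F) ≡ false →
    CL12 (G ++ plug C (subst x (var y) H) ∷ K ∘- F) → Wait-⊔x (G ++ plug C (CExists x H) ∷ K) F
  wait-⊔x-one G K C x H F y one fresh d G′ K′ C′ _ _ eq with plug-uniqueˡ G K C G′ K′ C′ ⊔xc ⊔xc eq one
  ... | refl , refl , refl , refl = y , fresh , d

wait-elementary : ∀ Γ F → profile (Γ ∘- F) ≡ (0 , 0 , 0 , 0) → Entails Γ F → CL12 (Γ ∘- F)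
wait-elementary Γ F p st =
  wait Γ F (stable Γ F st) (wait-⊓-none Γ F (#⊓ Γ F p)) (wait-⊔-none Γ F (#⊔ Γ F p))
              (wait-⊓x-none Γ F (#⊓x Γ F p)) (wait-⊔x-none Γ F (#⊔x Γ F p))

wait-⊓ : ∀ Γ C H₀ H₁ → let F = plug C (CAnd H₀ H₁) in
  profile (Γ ∘- F) ≡ (1 , 0 , 0 , 0) → Entails Γ F →
  CL12 (Γ ∘- plug C H₀) → CL12 (Γ ∘- plug C H₁) → CL12 (Γ ∘- F)
wait-⊓ Γ C H₀ H₁ p st d₀ d₁ =
  wait Γ F (stable Γ F st) (wait-⊓-one Γ C H₀ H₁ (#⊓ Γ F p) d₀ d₁) (wait-⊔-none Γ F (#⊔ Γ F p))
              (wait-⊓x-none Γ F (#⊓x Γ F p)) (wait-⊔x-none Γ F (#⊔x Γ F p))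
  where F = plug C (CAnd H₀ H₁)

wait-⊓x : ∀ Γ C x H y → let F = plug C (CForall x H) in
  profile (Γ ∘- F) ≡ (0 , 1 , 0 , 0) → occursSeq y (Γ ∘- F) ≡ false → Entails Γ F →
  CL12 (Γ ∘- plug C (subst x (var y) H)) → CL12 (Γ ∘- F)
wait-⊓x Γ C x H y p fresh st d =
  wait Γ F (stable Γ F st) (wait-⊓-none Γ F (#⊓ Γ F p)) (wait-⊔-none Γ F (#⊔ Γ F p))
              (wait-⊓x-one Γ C x H y (#⊓x Γ F p) fresh d) (wait-⊔x-none Γ F (#⊔x Γ F p))
  where F = plug C (CForall x H)

wait-⊔ : ∀ G K C H₀ H₁ F → let Γ = G ++ plug C (COr H₀ H₁) ∷ K in
  profile (Γ ∘- F) ≡ (0 , 0 , 1 , 0) → Entails Γ F →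
  CL12 (G ++ plug C H₀ ∷ K ∘- F) → CL12 (G ++ plug C H₁ ∷ K ∘- F) → CL12 (Γ ∘- F)
wait-⊔ G K C H₀ H₁ F p st d₀ d₁ =
  wait Γ F (stable Γ F st) (wait-⊓-none Γ F (#⊓ Γ F p)) (wait-⊔-one G K C H₀ H₁ F (#⊔ Γ F p) d₀ d₁)
              (wait-⊓x-none Γ F (#⊓x Γ F p)) (wait-⊔x-none Γ F (#⊔x Γ F p))
  where Γ = G ++ plug C (COr H₀ H₁) ∷ K

wait-⊔x : ∀ G K C x H F y → let Γ = G ++ plug C (CExists x H) ∷ K in
  profile (Γ ∘- F) ≡ (0 , 0 , 0 , 1) → occursSeq y (Γ ∘- F) ≡ false → Entails Γ F →
  CL12 (G ++ plug C (subst x (var y) H) ∷ K ∘- F) → CL12 (Γ ∘- F)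
wait-⊔x G K C x H F y p fresh st d =
  wait Γ F (stable Γ F st) (wait-⊓-none Γ F (#⊓ Γ F p)) (wait-⊔-none Γ F (#⊔ Γ F p))
              (wait-⊓x-none Γ F (#⊓x Γ F p)) (wait-⊔x-one G K C x H F y (#⊔x Γ F p) fresh d)
  where Γ = G ++ plug C (CExists x H) ∷ K

wait-⊓x-top : ∀ Γ x H y → profile (Γ ∘- CForall x H) ≡ (0 , 1 , 0 , 0) →
  occursSeq y (Γ ∘- CForall x H) ≡ false →
  CL12 (Γ ∘- subst x (var y) H) → CL12 (Γ ∘- CForall x H)
wait-⊓x-top Γ x H y p fresh = wait-⊓x Γ hole x H y p fresh entails-⊓x

wait-⊔-top : ∀ G K H₀ H₁ F → profile (G ++ COr H₀ H₁ ∷ K ∘- F) ≡ (0 , 0 , 1 , 0) →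
  CL12 (G ++ H₀ ∷ K ∘- F) → CL12 (G ++ H₁ ∷ K ∘- F) → CL12 (G ++ COr H₀ H₁ ∷ K ∘- F)
wait-⊔-top G K H₀ H₁ F p = wait-⊔ G K hole H₀ H₁ F p (entails-⊥-ante G (COr H₀ H₁) K F refl)

wait-⊔x-top : ∀ G K x H F y → profile (G ++ CExists x H ∷ K ∘- F) ≡ (0 , 0 , 0 , 1) →
  occursSeq y (G ++ CExists x H ∷ K ∘- F) ≡ false →
  CL12 (G ++ subst x (var y) H ∷ K ∘- F) → CL12 (G ++ CExists x H ∷ K ∘- F)
wait-⊔x-top G K x H F y p fresh =
  wait-⊔x G K hole x H F y p fresh (entails-⊥-ante G (CExists x H) K F refl)

-- Using a resource ⊓x⊔y H of the antecedent: we pick x := v, the environment answers y := z.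
⊓⊔-query : ∀ G K H F v z → let Γ = G ++ CExists 1 (subst 0 (var v) H) ∷ K in
  boundSeq v (Γ ∘- F) ≡ false → profile (Γ ∘- F) ≡ (0 , 0 , 0 , 1) → occursSeq z (Γ ∘- F) ≡ false →
  CL12 (G ++ subst 1 (var z) (subst 0 (var v) H) ∷ K ∘- F) →
  CL12 (G ++ CForall 0 (CExists 1 H) ∷ K ∘- F)
⊓⊔-query G K H F v z admissible p fresh d =
  ⊓x-choose G K hole 0 (CExists 1 H) (var v) F (inj₂ (v , refl , admissible))
    (wait-⊔x-top G K 1 (subst 0 (var v) H) F z p fresh d)

freeBelow : ℕ → Formula → Bool
freeBelow zero F = false
freeBelow (suc n) F = freeIn n F ∨ freeBelow n F

sentence : ∀ n F → freeBelow n F ≡ false → (∀ v → freeIn (n + v) F ≡ false) → Sentence F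
sentence zero F _ above = above
sentence (suc n) F below above with freeIn n F in eq
sentence (suc n) F below above | false = sentence n F below above′
  where
  above′ : ∀ v → freeIn (n + v) F ≡ false
  above′ zero = trans (cong (λ m → freeIn m F) (ℕₚ.+-identityʳ n)) eq
  above′ (suc v) = trans (cong (λ m → freeIn m F) (ℕₚ.+-suc n v)) (above v)

-- Closedness by evaluation: variables below 15 one by one, all others at once, which
-- computes whenever every variable of F is below 15.
consequence : ∀ {Es F} → All Provable Es →
  freeBelow 15 F ≡ false → (∀ v → freeIn (15 + v) F ≡ false) → CL12 (Es ∘- F) → Provable F
consequence {Es} {F} ps below above = lc Es F ps (sentence 15 F below above)

-- Binary length and powers of two

⌈log₂1+2^k⌉≡1+k : ∀ k → ⌈log₂ (suc (2 ^ k)) ⌉ ≡ suc k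
⌈log₂1+2^k⌉≡1+k zero = refl
⌈log₂1+2^k⌉≡1+k (suc k) = ∸1≡suc⇒ (begin
  ⌈log₂ (suc (2 ^ suc k)) ⌉ ∸ 1       ≡⟨ sym (⌈log₂⌈n/2⌉⌉≡⌈log₂n⌉∸1 (suc (2 ^ suc k))) ⟩
  ⌈log₂ ℕ.⌈ suc (2 ^ suc k) /2⌉ ⌉     ≡⟨ cong (λ m → ⌈log₂ ℕ.⌈ suc m /2⌉ ⌉) (cong (2 ^ k +_) (ℕₚ.+-identityʳ (2 ^ k))) ⟩
  ⌈log₂ ℕ.⌈ suc (2 ^ k + 2 ^ k) /2⌉ ⌉ ≡⟨ cong (λ m → ⌈log₂ suc m ⌉) (sym (ℕₚ.n≡⌊n+n/2⌋ (2 ^ k))) ⟩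
  ⌈log₂ (suc (2 ^ k)) ⌉               ≡⟨ ⌈log₂1+2^k⌉≡1+k k ⟩
  suc k                               ∎)
  where
  open ≡-Reasoning
  ∸1≡suc⇒ : ∀ {m n} → m ∸ 1 ≡ suc n → m ≡ suc (suc n)
  ∸1≡suc⇒ {suc m} e = cong suc e

⌈log₂⌉≤⇒≤2^ : ∀ m k → ⌈log₂ m ⌉ ≤ k → m ≤ 2 ^ k
⌈log₂⌉≤⇒≤2^ m k h with m ≤? 2 ^ k
... | yes m≤ = m≤
... | no m≰ = ⊥-elim (ℕₚ.<-irrefl refl (ℕₚ.≤-trans
        (transport (_≤ ⌈log₂ m ⌉) (⌈log₂1+2^k⌉≡1+k k) (⌈log₂⌉-mono-≤ (ℕₚ.≰⇒> m≰))) h))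

≤2^⇒⌈log₂⌉≤ : ∀ m k → m ≤ 2 ^ k → ⌈log₂ m ⌉ ≤ k
≤2^⇒⌈log₂⌉≤ m k h = transport (⌈log₂ m ⌉ ≤_) (⌈log₂2^n⌉≡n k) (⌈log₂⌉-mono-≤ h)

∣n∣≤k⇒n<2^k : ∀ n k → ∣ n ∣ ≤ k → n < 2 ^ k
∣n∣≤k⇒n<2^k n = ⌈log₂⌉≤⇒≤2^ (suc n)

n<2^k⇒∣n∣≤k : ∀ n k → n < 2 ^ k → ∣ n ∣ ≤ k
n<2^k⇒∣n∣≤k n = ≤2^⇒⌈log₂⌉≤ (suc n)

n<2^∣n∣ : ∀ n → n < 2 ^ ∣ n ∣
n<2^∣n∣ n = ∣n∣≤k⇒n<2^k n ∣ n ∣ ℕₚ.≤-refl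

∣∣-mono-≤ : ∀ {m n} → m ≤ n → ∣ m ∣ ≤ ∣ n ∣
∣∣-mono-≤ m≤n = ⌈log₂⌉-mono-≤ (s≤s m≤n)

even-or-odd : ∀ a → (Σ ℕ λ q → a ≡ q + q) ⊎ (Σ ℕ λ q → a ≡ suc (q + q))
even-or-odd zero = inj₁ (0 , refl)
even-or-odd (suc a) with even-or-odd a
... | inj₁ (q , e) = inj₂ (q , cong suc e)
... | inj₂ (q , e) = inj₁ (suc q , cong suc (trans e (sym (ℕₚ.+-suc q q))))

odd≢even : ∀ x y → suc (x + x) ≢ y + y
odd≢even zero zero ()
odd≢even zero (suc y) e with trans (ℕₚ.suc-injective e) (ℕₚ.+-suc y y)
... | ()
odd≢even (suc x) zero ()
odd≢even (suc x) (suc y) e = odd≢even x y (ℕₚ.suc-injective (ℕₚ.suc-injective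
  (trans (sym (cong suc (ℕₚ.+-suc (suc x) x))) (trans e (ℕₚ.+-suc (suc y) y)))))

double-injective : ∀ x y → x + x ≡ y + y → x ≡ y
double-injective x y e = ℕₚ.*-cancelˡ-≡ x y 2
  (trans (cong (x +_) (ℕₚ.+-identityʳ x)) (trans e (sym (cong (y +_) (ℕₚ.+-identityʳ y)))))

-- Powers of two are exactly the numbers without an odd factor other than 1; this is how
-- "is a power of two" becomes a PA formula.
NoOddFactor : ℕ → Set
NoOddFactor n = ∀ a c → a * suc (2 * c) ≡ n → c ≡ 0

IsPowerOf2 : ℕ → Set
IsPowerOf2 n = Σ ℕ λ k → n ≡ 2 ^ k

2^k-noOddFactor : ∀ k → NoOddFactor (2 ^ k)
2^k-noOddFactor zero a zero e = refl
2^k-noOddFactor zero a (suc c) e with ℕₚ.m*n≡1⇒n≡1 a (suc (2 * suc c)) e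
... | eq rewrite ℕₚ.+-suc c (c + 0) with eq
... | ()
2^k-noOddFactor (suc k) a c e with even-or-odd a
... | inj₁ (q , refl) = 2^k-noOddFactor k q c (double-injective _ _
        (trans (sym (ℕₚ.*-distribʳ-+ (suc (2 * c)) q q)) (trans e (cong (2 ^ k +_) (ℕₚ.+-identityʳ _)))))
... | inj₂ (q , refl) = ⊥-elim (odd≢even (q * suc (2 * c) + c) (2 ^ k)
        (trans (odd-product q c) (trans e (cong (2 ^ k +_) (ℕₚ.+-identityʳ _)))))
  where
  odd-product : ∀ q c → suc (q * suc (2 * c) + c + (q * suc (2 * c) + c)) ≡ suc (q + q) * suc (2 * c)
  odd-product = solve-∀

noOddFactor⇒power : ∀ n → NoOddFactor n → IsPowerOf2 n
noOddFactor⇒power = <-rec (λ n → NoOddFactor n → IsPowerOf2 n) step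
  where
  step : ∀ n → (∀ {m} → m < n → NoOddFactor m → IsPowerOf2 m) → NoOddFactor n → IsPowerOf2 n
  step n rec h with even-or-odd n
  ... | inj₂ (q , refl) with h 1 q (trans (ℕₚ.+-identityʳ _) (cong suc (cong (q +_) (ℕₚ.+-identityʳ q))))
  ...   | refl = 0 , refl
  step n rec h | inj₁ (zero , refl) with h 0 1 refl
  ...   | ()
  step n rec h | inj₁ (suc q , refl)
    with rec (s≤s (ℕₚ.m≤n+m (suc q) q))
             (λ a c e → h (a + a) c (trans (ℕₚ.*-distribʳ-+ (suc (2 * c)) a a) (cong₂ _+_ e e)))
  ...   | k , e = suc k , trans (cong₂ _+_ e e) (sym (cong (2 ^ k +_) (ℕₚ.+-identityʳ _)))

-- Size comparisons as PA formulas

-- Variables 10–14 are reserved for the bound variables of these formulas.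
PowerOf2 : Term → Formula
PowerOf2 t = Forall 11 (Forall 12 (Eq (var 11 ⊗ (var 12 ·1)) t ⇒ Eq (var 12) 𝟎))

Less : Term → Term → Formula
Less s t = Exists 13 (Eq (s ⊕ (var 13 ′)) t)

-- |s| ≤ |t|, i.e. every power of two above t is above s
SizeLe : Term → Term → Formula
SizeLe s t = Forall 10 (PowerOf2 (var 10) ⇒ (Less t (var 10) ⇒ Less s (var 10)))

-- |s| ≤ |t| + |u|
SizeLe₂ : Term → Term → Term → Formula
SizeLe₂ s t u = Forall 10 (Forall 14 (PowerOf2 (var 10) ⇒ (PowerOf2 (var 14) ⇒
                  (Less t (var 10) ⇒ (Less u (var 14) ⇒ Less s (var 10 ⊗ var 14))))))

any-++ : ∀ (f : ℕ → Bool) xs ys → any f (xs ++ ys) ≡ false →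
         any f xs ≡ false × any f ys ≡ false
any-++ f [] ys e = refl , e
any-++ f (x ∷ xs) ys e with f x
... | false = any-++ f xs ys e

evalT-update : ∀ M ρ x d t → inT x t ≡ false → evalT M (update ρ x d) t ≡ evalT M ρ t
evalT-update M ρ x d (var v) e with v ≡ᵇ x
... | false = refl
evalT-update M ρ x d 𝟎 e = refl
evalT-update M ρ x d (t ′) e = cong (sc M) (evalT-update M ρ x d t e)
evalT-update M ρ x d (s ⊕ t) e with any-++ (λ v → v ≡ᵇ x) (varsT s) (varsT t) e
... | es , et = cong₂ (pl M) (evalT-update M ρ x d s es) (evalT-update M ρ x d t et)
evalT-update M ρ x d (s ⊗ t) e with any-++ (λ v → v ≡ᵇ x) (varsT s) (varsT t) e
... | es , et = cong₂ (tm M) (evalT-update M ρ x d s es) (evalT-update M ρ x d t et)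

⟦_⟧_ : Term → (Var → ℕ) → ℕ
⟦ t ⟧ ρ = evalT ℕStr ρ t

module _ (s t : Term) (ρ : Var → ℕ) (s∌13 : inT 13 s ≡ false) (t∌13 : inT 13 t ≡ false) where

  Less⇒< : Sat ℕStr ρ (Less s t) → ⟦ s ⟧ ρ < ⟦ t ⟧ ρ
  Less⇒< h = decidable-stable (⟦ s ⟧ ρ <? ⟦ t ⟧ ρ) λ s≮t → h λ w ¬¬e → ¬¬e λ e → s≮t (witness w e)
    where
    witness : ∀ w → ⟦ s ⟧ update ρ 13 w + suc w ≡ ⟦ t ⟧ update ρ 13 w → ⟦ s ⟧ ρ < ⟦ t ⟧ ρ
    witness w e rewrite evalT-update ℕStr ρ 13 w s s∌13 | evalT-update ℕStr ρ 13 w t t∌13 =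
      transport (⟦ s ⟧ ρ <_) e (ℕₚ.m<m+n (⟦ s ⟧ ρ) (s≤s z≤n))

  <⇒Less : ⟦ s ⟧ ρ < ⟦ t ⟧ ρ → Sat ℕStr ρ (Less s t)
  <⇒Less s<t f = f w (λ k → k e)
    where
    w = ⟦ t ⟧ ρ ∸ suc (⟦ s ⟧ ρ)
    e : ⟦ s ⟧ update ρ 13 w + suc w ≡ ⟦ t ⟧ update ρ 13 w
    e rewrite evalT-update ℕStr ρ 13 w s s∌13 | evalT-update ℕStr ρ 13 w t t∌13 =
      trans (ℕₚ.+-suc (⟦ s ⟧ ρ) w) (ℕₚ.m+[n∸m]≡n s<t)

module _ (t : Term) (ρ : Var → ℕ) (t∌11 : inT 11 t ≡ false) (t∌12 : inT 12 t ≡ false) where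
  private
    ρ′ : ℕ → ℕ → Var → ℕ
    ρ′ a c = update (update ρ 11 a) 12 c

    ⟦t⟧ρ′ : ∀ a c → ⟦ t ⟧ ρ′ a c ≡ ⟦ t ⟧ ρ
    ⟦t⟧ρ′ a c = trans (evalT-update ℕStr (update ρ 11 a) 12 c t t∌12) (evalT-update ℕStr ρ 11 a t t∌11)

    Body = Eq (var 11 ⊗ (var 12 ·1)) t

  PowerOf2⇒ : Sat ℕStr ρ (PowerOf2 t) → IsPowerOf2 (⟦ t ⟧ ρ)
  PowerOf2⇒ h = noOddFactor⇒power _ λ a c e →
    decidable-stable (c ℕ.≟ 0) λ c≢0 →
      ⇒-elim ℕStr (ρ′ a c) Body (Eq (var 12) 𝟎) refl (h a c)
        (λ k → k (trans e (sym (⟦t⟧ρ′ a c)))) (λ ¬¬c≡0 → ¬¬c≡0 c≢0)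

  ⇒PowerOf2 : IsPowerOf2 (⟦ t ⟧ ρ) → Sat ℕStr ρ (PowerOf2 t)
  ⇒PowerOf2 (k , e) a c = ⇒-intro ℕStr (ρ′ a c) Body (Eq (var 12) 𝟎) refl
    λ ¬¬eq k′ → k′ (λ c≢0 → ¬¬eq (λ eq → c≢0 (2^k-noOddFactor k a c (trans eq (trans (⟦t⟧ρ′ a c) e)))))

module _ (s t : Term) (ρ : Var → ℕ)
         (s∌10 : inT 10 s ≡ false) (s∌13 : inT 13 s ≡ false)
         (t∌10 : inT 10 t ≡ false) (t∌13 : inT 13 t ≡ false) where
  private
    ρ′ : ℕ → Var → ℕ
    ρ′ P = update ρ 10 P

  SizeLe⇒ : Sat ℕStr ρ (SizeLe s t) → ∣ ⟦ s ⟧ ρ ∣ ≤ ∣ ⟦ t ⟧ ρ ∣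
  SizeLe⇒ h = decidable-stable (∣ ⟦ s ⟧ ρ ∣ ≤? ∣ ⟦ t ⟧ ρ ∣) λ ∣s∣≰∣t∣ →
    ⇒-elim ℕStr (ρ′ P) (PowerOf2 (var 10)) (Less t (var 10) ⇒ Less s (var 10)) refl (h P)
      (⇒PowerOf2 (var 10) (ρ′ P) refl refl (∣ ⟦ t ⟧ ρ ∣ , refl)) λ t<P⇒s<P →
    ⇒-elim ℕStr (ρ′ P) (Less t (var 10)) (Less s (var 10)) refl t<P⇒s<P
      (<⇒Less t (var 10) (ρ′ P) t∌13 refl
        (transport (_< P) (sym (evalT-update ℕStr ρ 10 P t t∌10)) (n<2^∣n∣ (⟦ t ⟧ ρ)))) λ s<P →
    ∣s∣≰∣t∣ (n<2^k⇒∣n∣≤k _ _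
      (transport (_< P) (evalT-update ℕStr ρ 10 P s s∌10) (Less⇒< s (var 10) (ρ′ P) s∌13 refl s<P)))
    where P = 2 ^ ∣ ⟦ t ⟧ ρ ∣

  ⇒SizeLe : ∣ ⟦ s ⟧ ρ ∣ ≤ ∣ ⟦ t ⟧ ρ ∣ → Sat ℕStr ρ (SizeLe s t)
  ⇒SizeLe le P =
    ⇒-intro ℕStr (ρ′ P) (PowerOf2 (var 10)) (Less t (var 10) ⇒ Less s (var 10)) refl λ pow k →
    k (⇒-intro ℕStr (ρ′ P) (Less t (var 10)) (Less s (var 10)) refl λ t<P k′ →
    k′ (<⇒Less s (var 10) (ρ′ P) s∌13 refl
         (below (PowerOf2⇒ (var 10) (ρ′ P) refl refl pow) (Less⇒< t (var 10) (ρ′ P) t∌13 refl t<P))))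
    where
    below : IsPowerOf2 P → ⟦ t ⟧ ρ′ P < P → ⟦ s ⟧ ρ′ P < P
    below (k , refl) t<P rewrite evalT-update ℕStr ρ 10 P s s∌10 | evalT-update ℕStr ρ 10 P t t∌10 =
      ∣n∣≤k⇒n<2^k _ k (ℕₚ.≤-trans le (n<2^k⇒∣n∣≤k _ k t<P))

module _ (s t u : Term) (ρ : Var → ℕ)
         (s∌10 : inT 10 s ≡ false) (s∌13 : inT 13 s ≡ false) (s∌14 : inT 14 s ≡ false)
         (t∌10 : inT 10 t ≡ false) (t∌13 : inT 13 t ≡ false) (t∌14 : inT 14 t ≡ false)
         (u∌10 : inT 10 u ≡ false) (u∌13 : inT 13 u ≡ false) (u∌14 : inT 14 u ≡ false) where
  private
    ρ′ : ℕ → ℕ → Var → ℕ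
    ρ′ P Q = update (update ρ 10 P) 14 Q

    ⟦_⟧ρ′ : ∀ r {P Q} → inT 10 r ≡ false → inT 14 r ≡ false → ⟦ r ⟧ ρ′ P Q ≡ ⟦ r ⟧ ρ
    ⟦ r ⟧ρ′ {P} {Q} r∌10 r∌14 =
      trans (evalT-update ℕStr (update ρ 10 P) 14 Q r r∌14) (evalT-update ℕStr ρ 10 P r r∌10)

    B₄ B₃ B₂ : Formula
    B₄ = Less u (var 14) ⇒ Less s (var 10 ⊗ var 14)
    B₃ = Less t (var 10) ⇒ B₄
    B₂ = PowerOf2 (var 14) ⇒ B₃

  SizeLe₂⇒ : Sat ℕStr ρ (SizeLe₂ s t u) → ∣ ⟦ s ⟧ ρ ∣ ≤ ∣ ⟦ t ⟧ ρ ∣ + ∣ ⟦ u ⟧ ρ ∣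
  SizeLe₂⇒ h = decidable-stable (∣ ⟦ s ⟧ ρ ∣ ≤? ∣ ⟦ t ⟧ ρ ∣ + ∣ ⟦ u ⟧ ρ ∣) λ ≰ →
    ⇒-elim ℕStr ρ″ (PowerOf2 (var 10)) B₂ refl (h P Q)
      (⇒PowerOf2 (var 10) ρ″ refl refl (∣ ⟦ t ⟧ ρ ∣ , refl)) λ h₂ →
    ⇒-elim ℕStr ρ″ (PowerOf2 (var 14)) B₃ refl h₂
      (⇒PowerOf2 (var 14) ρ″ refl refl (∣ ⟦ u ⟧ ρ ∣ , refl)) λ h₃ →
    ⇒-elim ℕStr ρ″ (Less t (var 10)) B₄ refl h₃
      (<⇒Less t (var 10) ρ″ t∌13 refl
        (transport (_< P) (sym (⟦ t ⟧ρ′ t∌10 t∌14)) (n<2^∣n∣ (⟦ t ⟧ ρ)))) λ h₄ →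
    ⇒-elim ℕStr ρ″ (Less u (var 14)) (Less s (var 10 ⊗ var 14)) refl h₄
      (<⇒Less u (var 14) ρ″ u∌13 refl
        (transport (_< Q) (sym (⟦ u ⟧ρ′ u∌10 u∌14)) (n<2^∣n∣ (⟦ u ⟧ ρ)))) λ s<PQ →
    ≰ (n<2^k⇒∣n∣≤k _ _
        (transport₂ _<_ (⟦ s ⟧ρ′ s∌10 s∌14) (sym (ℕₚ.^-distribˡ-+-* 2 (∣ ⟦ t ⟧ ρ ∣) (∣ ⟦ u ⟧ ρ ∣)))
          (Less⇒< s (var 10 ⊗ var 14) ρ″ s∌13 refl s<PQ)))
    where
    P = 2 ^ ∣ ⟦ t ⟧ ρ ∣
    Q = 2 ^ ∣ ⟦ u ⟧ ρ ∣
    ρ″ = ρ′ P Q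

  ⇒SizeLe₂ : ∣ ⟦ s ⟧ ρ ∣ ≤ ∣ ⟦ t ⟧ ρ ∣ + ∣ ⟦ u ⟧ ρ ∣ → Sat ℕStr ρ (SizeLe₂ s t u)
  ⇒SizeLe₂ le P Q =
    ⇒-intro ℕStr ρ″ (PowerOf2 (var 10)) B₂ refl λ powP k₁ → k₁ (
    ⇒-intro ℕStr ρ″ (PowerOf2 (var 14)) B₃ refl λ powQ k₂ → k₂ (
    ⇒-intro ℕStr ρ″ (Less t (var 10)) B₄ refl λ t<P k₃ → k₃ (
    ⇒-intro ℕStr ρ″ (Less u (var 14)) (Less s (var 10 ⊗ var 14)) refl λ u<Q k₄ → k₄ (
      <⇒Less s (var 10 ⊗ var 14) ρ″ s∌13 refl
        (below (PowerOf2⇒ (var 10) ρ″ refl refl powP) (PowerOf2⇒ (var 14) ρ″ refl refl powQ)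
               (Less⇒< t (var 10) ρ″ t∌13 refl t<P) (Less⇒< u (var 14) ρ″ u∌13 refl u<Q))))))
    where
    ρ″ = ρ′ P Q
    below : IsPowerOf2 P → IsPowerOf2 Q → ⟦ t ⟧ ρ″ < P → ⟦ u ⟧ ρ″ < Q → ⟦ s ⟧ ρ″ < P * Q
    below (k₁ , refl) (k₂ , refl) t<P u<Q
      rewrite ⟦ s ⟧ρ′ {2 ^ k₁} {2 ^ k₂} s∌10 s∌14 | ⟦ t ⟧ρ′ {2 ^ k₁} {2 ^ k₂} t∌10 t∌14
            | ⟦ u ⟧ρ′ {2 ^ k₁} {2 ^ k₂} u∌10 u∌14 =
      transport (⟦ s ⟧ ρ <_) (ℕₚ.^-distribˡ-+-* 2 k₁ k₂)
        (∣n∣≤k⇒n<2^k _ _ (ℕₚ.≤-trans le (ℕₚ.+-mono-≤ (n<2^k⇒∣n∣≤k _ k₁ t<P) (n<2^k⇒∣n∣≤k _ k₂ u<Q))))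

-- The three induction formulas

-- Each answer bound S(y) below has the shape (answer equations) ∨ |y| ≤ ...: it is still a
-- sizebound, because the equations imply the size inequality, but in a derivation it follows
-- from the answer alone, with no arithmetic on sizes.

x≡y0 x≡y1 halving-bound Halving : Formula
x≡y0 = Eq (var 0) (var 1 ·0)
x≡y1 = Eq (var 0) (var 1 ·1)
halving-bound = Or (Or x≡y0 x≡y1) (SizeLe (var 1) (var 0))
Halving = CExists 1 (And halving-bound (COr x≡y0 x≡y1))

x≡y′ predecessor-bound Predecessor : Formula
x≡y′ = Eq (var 0) (var 1 ′)
predecessor-bound = Or x≡y′ (SizeLe (var 1) (var 0))
Predecessor = COr (Eq (var 0) 𝟎) (CExists 1 (And predecessor-bound x≡y′))

-- x = var 0, the parameter p = var 1, v = var 2, z = var 3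
x≡v+z v≡x+z+1 v-bound z-bound Comparison : Formula
x≡v+z = Eq (var 0) (var 2 ⊕ var 3)
v≡x+z+1 = Eq (var 2) ((var 0 ⊕ var 3) ′)
v-bound = SizeLe (var 2) (var 1)
z-bound = Or (Or x≡v+z v≡x+z+1) (SizeLe₂ (var 3) (var 0) (var 2))
Comparison = CForall 2 (v-bound ⇒ CExists 3 (And z-bound (COr x≡v+z v≡x+z+1)))

halving-sizebound : SizeBound 1 halving-bound
halving-sizebound = refl , var 0 , refl , λ ρ → mk⇔ (to ρ)
  (λ le → ∨-introʳ ℕStr ρ (Or x≡y0 x≡y1) (SizeLe (var 1) (var 0)) (⇒SizeLe (var 1) (var 0) ρ refl refl refl refl le))
  where
  to : ∀ ρ → Sat ℕStr ρ halving-bound → ∣ ρ 1 ∣ ≤ ∣ ρ 0 ∣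
  to ρ h = decidable-stable (∣ ρ 1 ∣ ≤? ∣ ρ 0 ∣) λ ≰ → h
    ((λ ¬¬eqs → ¬¬eqs
       ((λ ¬¬e → ¬¬e λ e → ≰ (∣∣-mono-≤ (transport (ρ 1 ≤_) (sym e) (ℕₚ.m≤m+n (ρ 1) _)))) ,
        (λ ¬¬e → ¬¬e λ e → ≰ (∣∣-mono-≤ (transport (ρ 1 ≤_) (sym e) (ℕₚ.m≤n⇒m≤1+n (ℕₚ.m≤m+n (ρ 1) _))))))) ,
     (λ r → ≰ (SizeLe⇒ (var 1) (var 0) ρ refl refl refl refl r)))

predecessor-sizebound : SizeBound 1 predecessor-bound
predecessor-sizebound = refl , var 0 , refl , λ ρ → mk⇔ (to ρ)
  (λ le → ∨-introʳ ℕStr ρ x≡y′ (SizeLe (var 1) (var 0)) (⇒SizeLe (var 1) (var 0) ρ refl refl refl refl le))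
  where
  to : ∀ ρ → Sat ℕStr ρ predecessor-bound → ∣ ρ 1 ∣ ≤ ∣ ρ 0 ∣
  to ρ h = decidable-stable (∣ ρ 1 ∣ ≤? ∣ ρ 0 ∣) λ ≰ → h
    ((λ ¬¬e → ¬¬e λ e → ≰ (∣∣-mono-≤ (transport (ρ 1 ≤_) (sym e) (ℕₚ.n≤1+n (ρ 1))))) ,
     (λ r → ≰ (SizeLe⇒ (var 1) (var 0) ρ refl refl refl refl r)))

v-sizebound : SizeBound 2 v-bound
v-sizebound = refl , var 1 , refl , λ ρ →
  mk⇔ (SizeLe⇒ (var 2) (var 1) ρ refl refl refl refl) (⇒SizeLe (var 2) (var 1) ρ refl refl refl refl)

z-sizebound : SizeBound 3 z-bound
z-sizebound = refl , var 0 ⊕ var 2 , refl , λ ρ → mk⇔ (to ρ)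
  (λ le → ∨-introʳ ℕStr ρ (Or x≡v+z v≡x+z+1) (SizeLe₂ (var 3) (var 0) (var 2))
            (⇒SizeLe₂ (var 3) (var 0) (var 2) ρ refl refl refl refl refl refl refl refl refl le))
  where
  to : ∀ ρ → Sat ℕStr ρ z-bound → ∣ ρ 3 ∣ ≤ ∣ ρ 0 ∣ + ∣ ρ 2 ∣
  to ρ h = decidable-stable (∣ ρ 3 ∣ ≤? ∣ ρ 0 ∣ + ∣ ρ 2 ∣) λ ≰ → h
    ((λ ¬¬eqs → ¬¬eqs
       ((λ ¬¬e → ¬¬e λ e → ≰ (ℕₚ.≤-trans
           (∣∣-mono-≤ (transport (ρ 3 ≤_) (sym e) (ℕₚ.m≤n+m (ρ 3) (ρ 2)))) (ℕₚ.m≤m+n _ _))) ,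
        (λ ¬¬e → ¬¬e λ e → ≰ (ℕₚ.≤-trans
           (∣∣-mono-≤ (transport (ρ 3 ≤_) (sym e) (ℕₚ.m≤n⇒m≤1+n (ℕₚ.m≤n+m (ρ 3) (ρ 0))))) (ℕₚ.m≤n+m _ _))))) ,
     (λ r → ≰ (SizeLe₂⇒ (var 3) (var 0) (var 2) ρ refl refl refl refl refl refl refl refl refl r)))

Halving-bounded : PolyBounded Halving
Halving-bounded = pbCExists 1 _ _ halving-sizebound (pbCOr (pbEq _ _) (pbEq _ _))

Predecessor-bounded : PolyBounded Predecessor
Predecessor-bounded = pbCOr (pbEq _ _) (pbCExists 1 _ _ predecessor-sizebound (pbEq _ _))

Comparison-bounded : PolyBounded Comparison
Comparison-bounded = pbCForall 2 _ _ v-sizebound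
  (pbCExists 3 _ _ z-sizebound (pbCOr (pbEq _ _) (pbEq _ _)))

-- Equality in an arbitrary model, read classically

module ClassicalEquality (M : Structure) where

  infix 4 _≈_
  _≈_ : D M → D M → Set
  a ≈ b = ¬ ¬ (a ≡ b)

  ≈-reflexive : ∀ {a b} → a ≡ b → a ≈ b
  ≈-reflexive e k = k e

  ≈-refl : ∀ {a} → a ≈ a
  ≈-refl = ≈-reflexive refl

  ≈-sym : ∀ {a b} → a ≈ b → b ≈ a
  ≈-sym p k = p (λ e → k (sym e))

  ≈-trans : ∀ {a b c} → a ≈ b → b ≈ c → a ≈ c
  ≈-trans p q k = p (λ e₁ → q (λ e₂ → k (trans e₁ e₂)))

  ≈-cong : ∀ (f : D M → D M) {a b} → a ≈ b → f a ≈ f b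
  ≈-cong f p k = p (λ e → k (cong f e))

  ≈-cong₂ : ∀ (f : D M → D M → D M) {a b c d} → a ≈ b → c ≈ d → f a c ≈ f b d
  ≈-cong₂ f p q k = p (λ e₁ → q (λ e₂ → k (cong₂ f e₁ e₂)))

  ≈-setoid : Setoid 0ℓ 0ℓ
  ≈-setoid = record
    { Carrier = D M ; _≈_ = _≈_
    ; isEquivalence = record { refl = ≈-refl ; sym = ≈-sym ; trans = ≈-trans } }

  module ≈-Reasoning = Relation.Binary.Reasoning.Setoid ≈-setoid

  record AdditiveLaws : Set where
    field
      +-identityʳ : ∀ a → pl M a (z M) ≈ a
      +-suc       : ∀ a b → pl M a (sc M b) ≈ sc M (pl M a b)
      +-identityˡ : ∀ a → pl M (z M) a ≈ a
      suc-+       : ∀ a b → pl M (sc M a) b ≈ sc M (pl M a b)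
      +-comm      : ∀ a b → pl M a b ≈ pl M b a
      +-assoc     : ∀ a b c → pl M (pl M a b) c ≈ pl M a (pl M b c)
      2*-double   : ∀ a → tm M (sc M (sc M (z M))) a ≈ pl M a a
      suc-injective : ∀ a b → sc M a ≈ sc M b → a ≈ b

  -- A decision procedure for equations between terms built from 0, ′, + and doubling τ0:
  -- both sides are normalised to (number of ′, sorted list of variables).
  module Linear (laws : AdditiveLaws) (ρ : Var → D M) where
    open AdditiveLaws laws

    private
      _+ᴹ_ = pl M
      sucᴹ = sc M

      sum : List ℕ → D M
      sum [] = z M
      sum (i ∷ is) = ρ i +ᴹ sum is

      sucs : ℕ → D M → D M
      sucs zero a = a
      sucs (suc k) a = sucᴹ (sucs k a)

      insert : ℕ → List ℕ → List ℕ
      insert i [] = i ∷ []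
      insert i (j ∷ js) = if i ≤ᵇ j then i ∷ j ∷ js else j ∷ insert i js

      merge : List ℕ → List ℕ → List ℕ
      merge xs ys = foldr insert ys xs

      +-swap : ∀ a b c → a +ᴹ (b +ᴹ c) ≈ b +ᴹ (a +ᴹ c)
      +-swap a b c = ≈-trans (≈-sym (+-assoc a b c)) (≈-trans (≈-cong (_+ᴹ c) (+-comm a b)) (+-assoc b a c))

      sum-insert : ∀ i js → sum (insert i js) ≈ ρ i +ᴹ sum js
      sum-insert i [] = ≈-refl
      sum-insert i (j ∷ js) with i ≤ᵇ j
      ... | true = ≈-refl
      ... | false = ≈-trans (≈-cong (ρ j +ᴹ_) (sum-insert i js)) (+-swap (ρ j) (ρ i) (sum js))

      sum-merge : ∀ xs ys → sum (merge xs ys) ≈ sum xs +ᴹ sum ys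
      sum-merge [] ys = ≈-sym (+-identityˡ _)
      sum-merge (x ∷ xs) ys = ≈-trans (sum-insert x (merge xs ys))
        (≈-trans (≈-cong (ρ x +ᴹ_) (sum-merge xs ys)) (≈-sym (+-assoc _ _ _)))

      sucs-+ : ∀ k a b → sucs k a +ᴹ b ≈ sucs k (a +ᴹ b)
      sucs-+ zero a b = ≈-refl
      sucs-+ (suc k) a b = ≈-trans (suc-+ _ _) (≈-cong sucᴹ (sucs-+ k a b))

      +-sucs : ∀ k a b → a +ᴹ sucs k b ≈ sucs k (a +ᴹ b)
      +-sucs zero a b = ≈-refl
      +-sucs (suc k) a b = ≈-trans (+-suc _ _) (≈-cong sucᴹ (+-sucs k a b))

      sucs-sucs : ∀ k m a → sucs k (sucs m a) ≡ sucs (k + m) a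
      sucs-sucs zero m a = refl
      sucs-sucs (suc k) m a = cong sucᴹ (sucs-sucs k m a)

      Normal : Set
      Normal = ℕ × List ℕ

      ⟦_⟧ₙ : Normal → D M
      ⟦ k , is ⟧ₙ = sucs k (sum is)

      _+ₙ_ : Normal → Normal → Normal
      (k , xs) +ₙ (m , ys) = k + m , merge xs ys

      +ₙ-sound : ∀ n₁ n₂ → ⟦ n₁ +ₙ n₂ ⟧ₙ ≈ ⟦ n₁ ⟧ₙ +ᴹ ⟦ n₂ ⟧ₙ
      +ₙ-sound (k , xs) (m , ys) = ≈-trans (≈-cong (sucs (k + m)) (sum-merge xs ys)) (≈-sym (
        ≈-trans (sucs-+ k _ (sucs m _)) (≈-trans (≈-cong (sucs k) (+-sucs m _ _)) (≈-reflexive (sucs-sucs k m _)))))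

      normal : Term → Maybe Normal
      normal (var i) = just (0 , i ∷ [])
      normal 𝟎 = just (0 , [])
      normal (t ′) with normal t
      ... | just (k , is) = just (suc k , is)
      ... | nothing = nothing
      normal (s ⊕ t) with normal s | normal t
      ... | just n₁ | just n₂ = just (n₁ +ₙ n₂)
      ... | _ | _ = nothing
      normal ((𝟎 ′ ′) ⊗ t) with normal t
      ... | just n = just (n +ₙ n)
      ... | nothing = nothing
      normal (_ ⊗ _) = nothing

      normal-sound : ∀ t n → normal t ≡ just n → evalT M ρ t ≈ ⟦ n ⟧ₙ
      normal-sound (var i) _ refl = ≈-sym (+-identityʳ _)
      normal-sound 𝟎 _ refl = ≈-refl
      normal-sound (t ′) n e with normal t in eq
      normal-sound (t ′) _ refl | just (k , is) = ≈-cong sucᴹ (normal-sound t _ eq)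
      normal-sound (s ⊕ t) n e with normal s in e₁ | normal t in e₂
      normal-sound (s ⊕ t) _ refl | just n₁ | just n₂ =
        ≈-trans (≈-cong₂ _+ᴹ_ (normal-sound s _ e₁) (normal-sound t _ e₂)) (≈-sym (+ₙ-sound n₁ n₂))
      normal-sound (s ⊕ t) n () | just n₁ | nothing
      normal-sound (s ⊕ t) n () | nothing | _
      normal-sound ((𝟎 ′ ′) ⊗ t) n e with normal t in e₁
      normal-sound ((𝟎 ′ ′) ⊗ t) _ refl | just n₁ =
        ≈-trans (2*-double _) (≈-trans (≈-cong₂ _+ᴹ_ (normal-sound t _ e₁) (normal-sound t _ e₁)) (≈-sym (+ₙ-sound n₁ n₁)))
      normal-sound (var _ ⊗ _) n ()
      normal-sound (𝟎 ⊗ _) n ()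
      normal-sound (var _ ′ ⊗ _) n ()
      normal-sound (𝟎 ′ ⊗ _) n ()
      normal-sound (_ ′ ′ ′ ⊗ _) n ()
      normal-sound (var _ ′ ′ ⊗ _) n ()
      normal-sound ((_ ⊕ _) ′ ′ ⊗ _) n ()
      normal-sound ((_ ⊗ _) ′ ′ ⊗ _) n ()
      normal-sound ((_ ⊕ _) ′ ⊗ _) n ()
      normal-sound ((_ ⊗ _) ′ ⊗ _) n ()
      normal-sound ((_ ⊕ _) ⊗ _) n ()
      normal-sound ((_ ⊗ _) ⊗ _) n ()

    solve : ∀ s t {n} → normal s ≡ just n → normal t ≡ just n → evalT M ρ s ≈ evalT M ρ t
    solve s t e₁ e₂ = ≈-trans (normal-sound s _ e₁) (≈-sym (normal-sound t _ e₂))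

-- Additive laws provable by elementary induction

InductionHyp : Formula → Var → Formula
InductionHyp F x = And (subst x 𝟎 F) (Forall x (F ⇒ subst x (var x ′) F))

⊢Induction : ∀ F x → Elementary F → Provable (∀closure (InductionHyp F x ⇒ Forall x F))
⊢Induction F x e = axiom (ax7 F x e)

by-induction : ∀ M ρ F x → Elementary F → Elementary (InductionHyp F x) →
  Sat M ρ (InductionHyp F x ⇒ Forall x F) → Sat M ρ (subst x 𝟎 F) →
  (∀ d → Sat M (update ρ x d) F → Sat M (update ρ x d) (subst x (var x ′) F)) →
  Sat M ρ (Forall x F)
by-induction M ρ F x eF eH ind base step = sat-¬¬ M (Forall x F) ρ eF
  (⇒-elim M ρ (InductionHyp F x) (Forall x F) eH ind
    (base , λ d → ⇒-intro M (update ρ x d) F (subst x (var x ′) F) eF λ h k → k (step d h)))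

valid-consequence : ∀ {Es} F → All Provable Es → profile (Es ∘- F) ≡ (0 , 0 , 0 , 0) →
  freeBelow 15 F ≡ false → (∀ v → freeIn (15 + v) F ≡ false) →
  (∀ M ρ → SatAnte M ρ Es → ¬ ¬ Sat M ρ ‖ F ‖) → Provable F
valid-consequence {Es} F ps p below above valid =
  consequence ps below above (wait-elementary Es F p (entails valid))

SucInjective AddZero AddSuc : Formula
SucInjective = Forall 0 (Forall 1 (Eq (var 0 ′) (var 1 ′) ⇒ Eq (var 0) (var 1)))
AddZero = Forall 0 (Eq (var 0 ⊕ 𝟎) (var 0))
AddSuc = Forall 0 (Forall 1 (Eq (var 0 ⊕ var 1 ′) ((var 0 ⊕ var 1) ′)))

zero+x suc+ +comm +assoc double : Formula
zero+x = Eq (𝟎 ⊕ var 0) (var 0)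
suc+ = Eq (var 0 ′ ⊕ var 1) ((var 0 ⊕ var 1) ′)
+comm = Eq (var 0 ⊕ var 1) (var 1 ⊕ var 0)
+assoc = Eq ((var 0 ⊕ var 1) ⊕ var 2) (var 0 ⊕ (var 1 ⊕ var 2))
double = Eq (var 0 ·0) (var 0 ⊕ var 0)

ZeroAdd SucAdd AddComm AddAssoc Double Additive : Formula
ZeroAdd = Forall 0 zero+x
SucAdd = Forall 0 (Forall 1 suc+)
AddComm = Forall 0 (Forall 1 +comm)
AddAssoc = Forall 0 (Forall 1 (Forall 2 +assoc))
Double = Forall 0 double
Additive = And ZeroAdd (And SucAdd (And AddComm (And AddAssoc (And Double (And SucInjective (And AddZero AddSuc))))))

⊢ZeroAdd : Provable ZeroAdd
⊢ZeroAdd = valid-consequence ZeroAdd (⊢Induction zero+x 0 refl ∷ axiom ax3 ∷ axiom ax4 ∷ [])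
  refl refl (λ _ → refl) λ M ρ (ind , +0 , +s) k → let open ClassicalEquality M in
    k (by-induction M ρ zero+x 0 refl refl ind
         (+0 (z M))
         λ a ih → ≈-trans (+s (z M) a) (≈-cong (sc M) ih))

⊢SucAdd : Provable SucAdd
⊢SucAdd = valid-consequence SucAdd (⊢Induction suc+ 1 refl ∷ axiom ax3 ∷ axiom ax4 ∷ [])
  refl refl (λ _ → refl) λ M ρ (ind , +0 , +s) k → let open ClassicalEquality M in
    k λ a → by-induction M (update ρ 0 a) suc+ 1 refl refl (ind a)
              (≈-trans (+0 (sc M a)) (≈-cong (sc M) (≈-sym (+0 a))))
              λ b ih → ≈-trans (+s (sc M a) b) (≈-trans (≈-cong (sc M) ih) (≈-cong (sc M) (≈-sym (+s a b))))

⊢AddComm : Provable AddComm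
⊢AddComm = valid-consequence AddComm (⊢Induction +comm 1 refl ∷ axiom ax3 ∷ axiom ax4 ∷ ⊢ZeroAdd ∷ ⊢SucAdd ∷ [])
  refl refl (λ _ → refl) λ M ρ (ind , +0 , +s , 0+ , s+) k → let open ClassicalEquality M in
    k λ a → by-induction M (update ρ 0 a) +comm 1 refl refl (ind a)
              (≈-trans (+0 a) (≈-sym (0+ a)))
              λ b ih → ≈-trans (+s a b) (≈-trans (≈-cong (sc M) ih) (≈-sym (s+ b a)))

⊢AddAssoc : Provable AddAssoc
⊢AddAssoc = valid-consequence AddAssoc (⊢Induction +assoc 2 refl ∷ axiom ax3 ∷ axiom ax4 ∷ [])
  refl refl (λ _ → refl) λ M ρ (ind , +0 , +s) k → let open ClassicalEquality M in
    k λ a b → by-induction M (update (update ρ 0 a) 1 b) +assoc 2 refl refl (ind a b)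
                (≈-trans (+0 _) (≈-cong (pl M a) (≈-sym (+0 b))))
                λ c ih → ≈-trans (+s (pl M a b) c) (≈-trans (≈-cong (sc M) ih)
                           (≈-trans (≈-sym (+s a (pl M b c))) (≈-cong (pl M a) (≈-sym (+s b c)))))

⊢Double : Provable Double
⊢Double = valid-consequence Double
  (⊢Induction double 0 refl ∷ axiom ax3 ∷ axiom ax4 ∷ axiom ax5 ∷ axiom ax6 ∷ ⊢SucAdd ∷ [])
  refl refl (λ _ → refl) λ M ρ (ind , +0 , +s , *0 , *s , s+) k →
    let open ClassicalEquality M
        two = sc M (sc M (z M))
    in k (by-induction M ρ double 0 refl refl ind
            (≈-trans (*0 two) (≈-sym (+0 (z M))))
            λ a ih → ≈-trans (*s two a) (≈-trans (≈-cong (λ t → pl M t two) ih)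
                       (≈-trans (+s (pl M a a) (sc M (z M)))
                       (≈-trans (≈-cong (sc M) (≈-trans (+s (pl M a a) (z M)) (≈-cong (sc M) (+0 _))))
                       (≈-sym (≈-trans (+s (sc M a) a) (≈-cong (sc M) (s+ a a))))))))

⊢Additive : Provable Additive
⊢Additive = valid-consequence Additive
  (⊢ZeroAdd ∷ ⊢SucAdd ∷ ⊢AddComm ∷ ⊢AddAssoc ∷ ⊢Double ∷ axiom ax2 ∷ axiom ax3 ∷ axiom ax4 ∷ [])
  refl refl (λ _ → refl) λ M ρ h k → k h

additive-laws : ∀ M ρ → Sat M ρ Additive → ClassicalEquality.AdditiveLaws M
additive-laws M ρ (0+ , s+ , comm , assoc , dbl , inj , +0 , +s) = record
  { +-identityʳ = +0 ; +-suc = +s ; +-identityˡ = 0+ ; suc-+ = s+ ; +-comm = comm ; +-assoc = assoc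
  ; 2*-double = dbl
  ; suc-injective = λ a b h k →
      ⇒-elim M (update (update ρ 0 a) 1 b) (Eq (var 0 ′) (var 1 ′)) (Eq (var 0) (var 1)) refl (inj a b) h (λ ¬e → ¬e k) }

-- Halving: ⊓x ⊔y (x = y0 ⊔ x = y1)

-- In the derivations, the values moved by either player are named by fresh variables from 20
-- on; the variables below 15 are those of the formulas themselves.

⊢Halving-base : Provable (⊓closure (subst 0 𝟎 Halving))
⊢Halving-base = consequence (⊢Additive ∷ []) refl (λ _ → refl)
  (⊔x-choose _ hole 1 _ 𝟎 (inj₁ refl)
  (⊔-choose _ (andR _ hole) _ _ false
  (wait-elementary _ _ refl (entails λ M ρ laws k →
    let open ClassicalEquality M
        open AdditiveLaws (additive-laws M ρ laws)
        0≈0·0 = ≈-sym (≈-trans (2*-double (z M)) (+-identityʳ (z M)))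
    in k ((λ (¬eqs , _) → ¬eqs (λ (¬e₀ , _) → ¬e₀ 0≈0·0)) , 0≈0·0)))))

-- x0 and x1 are halved by x itself: the induction hypothesis is not consulted.
⊢Halving-step₀ : Provable (⊓closure (Halving ⇒ subst 0 (var 0 ·0) Halving))
⊢Halving-step₀ = consequence [] refl (λ _ → refl) $
  wait-⊓x-top [] 0 _ 20 refl refl $
  ⊔x-choose _ (orR _ hole) 1 _ (var 20) (inj₂ (20 , refl , refl)) $
  ⊔-choose _ (orR _ (andR _ hole)) _ _ false $
  wait-⊓x _ (orL hole _) 1 _ 21 refl refl (entails-∨ʳ x0≡x0) $
  wait-⊓ _ (orL (orR _ hole) _) _ _ refl (entails-∨ʳ x0≡x0)
    (wait-elementary _ _ refl (entails-∨ʳ x0≡x0))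
    (wait-elementary _ _ refl (entails-∨ʳ x0≡x0))
  where
  x0≡x0 : ∀ M ρ → SatAnte M ρ [] → _
  x0≡x0 M ρ _ = (λ (¬eqs , _) → ¬eqs (λ (¬e₀ , _) → ¬e₀ λ k → k refl)) , (λ k → k refl)

⊢Halving-step₁ : Provable (⊓closure (Halving ⇒ subst 0 (var 0 ·1) Halving))
⊢Halving-step₁ = consequence [] refl (λ _ → refl) $
  wait-⊓x-top [] 0 _ 20 refl refl $
  ⊔x-choose _ (orR _ hole) 1 _ (var 20) (inj₂ (20 , refl , refl)) $
  ⊔-choose _ (orR _ (andR _ hole)) _ _ true $
  wait-⊓x _ (orL hole _) 1 _ 21 refl refl (entails-∨ʳ x1≡x1) $
  wait-⊓ _ (orL (orR _ hole) _) _ _ refl (entails-∨ʳ x1≡x1)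
    (wait-elementary _ _ refl (entails-∨ʳ x1≡x1))
    (wait-elementary _ _ refl (entails-∨ʳ x1≡x1))
  where
  x1≡x1 : ∀ M ρ → SatAnte M ρ [] → _
  x1≡x1 M ρ _ = (λ (¬eqs , _) → ¬eqs (λ (_ , ¬e₁) → ¬e₁ λ k → k refl)) , (λ k → k refl)

⊢Halving : Provable (⊓closure Halving)
⊢Halving = induction Halving 0 Halving-bounded ⊢Halving-base ⊢Halving-step₀ ⊢Halving-step₁

-- Predecessor: ⊓x (x = 0 ⊔ ⊔y x = y′)

Successor Doubling : Formula
Successor = CForall 0 (CExists 1 (Eq (var 1) (var 0 ′)))
Doubling = CForall 0 (CExists 1 (Eq (var 1) (var 0 ·0)))

⊢Successor : Provable Successor
⊢Successor = axiom ax8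

⊢Doubling : Provable Doubling
⊢Doubling = axiom ax9

⊢Predecessor-base : Provable (⊓closure (subst 0 𝟎 Predecessor))
⊢Predecessor-base = consequence [] refl (λ _ → refl) $
  ⊔-choose _ hole _ _ false $
  wait-elementary _ _ refl (entails λ M ρ _ k → k λ k′ → k′ refl)

⊢Predecessor-step₀ : Provable (⊓closure (Predecessor ⇒ subst 0 (var 0 ·0) Predecessor))
⊢Predecessor-step₀ = consequence (⊢Additive ∷ ⊢Doubling ∷ ⊢Successor ∷ []) refl (λ _ → refl) $
  wait-⊓x-top _ 0 _ 20 refl refl $
  wait-⊓ _ (orL hole _) _ _ refl (entails λ M ρ _ k → k λ (¬⊤ , _) → ¬⊤ tt)
    (⊔-choose _ (orR _ hole) _ _ false $
     wait-elementary _ _ refl (entails x≡0⇒x0≡0))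
    (wait-⊓x _ (orL hole _) 1 _ 21 refl refl (entails λ M ρ _ k → k λ (¬⊤ , _) → ¬⊤ tt) $
     ⊓⊔-query (Additive ∷ []) _ _ _ 21 22 refl refl refl $
     ⊓⊔-query (Additive ∷ Eq (var 22) (var 21 ·0) ∷ []) _ _ _ 22 23 refl refl refl $
     ⊔-choose _ (orR _ hole) _ _ true $
     ⊔x-choose _ (orR _ hole) 1 _ (var 23) (inj₂ (23 , refl , refl)) $
     wait-elementary _ _ refl (entails x≡y′⇒x0≡[y0]′′))
  where
  x≡0⇒x0≡0 : ∀ M ρ → SatAnte M ρ (Additive ∷ Doubling ∷ Successor ∷ []) → _
  x≡0⇒x0≡0 M ρ (laws , _) k = k λ (x≈0 , ¬x0≈0) → ¬x0≈0
    (≈-trans (≈-cong (tm M (sc M (sc M (z M)))) x≈0) (≈-trans (2*-double _) (+-identityʳ _)))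
    where open ClassicalEquality M
          open AdditiveLaws (additive-laws M ρ laws)

  x≡y′⇒x0≡[y0]′′ : ∀ M ρ → SatAnte M ρ (Additive ∷ Eq (var 22) (var 21 ·0) ∷ Eq (var 23) (var 22 ′) ∷ []) → _
  x≡y′⇒x0≡[y0]′′ M ρ (laws , y₀≈y0 , y₁≈y₀′) k =
    k λ (¬IH , ¬ours) → ¬IH λ (_ , x≈y′) → ¬ours ((λ (¬eq , _) → ¬eq (x0≈y₁′ x≈y′)) , x0≈y₁′ x≈y′)
    where
    open ClassicalEquality M
    open Linear (additive-laws M ρ laws) ρ
    open ≈-Reasoning
    x0≈y₁′ : ρ 20 ≈ sc M (ρ 21) → evalT M ρ (var 20 ·0) ≈ evalT M ρ (var 23 ′)
    x0≈y₁′ x≈y′ = begin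
      evalT M ρ (var 20 ·0)       ≈⟨ ≈-cong (tm M (sc M (sc M (z M)))) x≈y′ ⟩
      evalT M ρ ((var 21 ′) ·0)   ≈⟨ solve ((var 21 ′) ·0) ((var 21 ·0) ′ ′) refl refl ⟩
      evalT M ρ ((var 21 ·0) ′ ′) ≈⟨ ≈-cong (λ a → sc M (sc M a)) (≈-sym y₀≈y0) ⟩
      evalT M ρ (var 22 ′ ′)      ≈⟨ ≈-cong (sc M) (≈-sym y₁≈y₀′) ⟩
      evalT M ρ (var 23 ′)        ∎

-- The predecessor of x1 is x0, whatever the induction hypothesis says.
⊢Predecessor-step₁ : Provable (⊓closure (Predecessor ⇒ subst 0 (var 0 ·1) Predecessor))
⊢Predecessor-step₁ = consequence (⊢Additive ∷ ⊢Doubling ∷ []) refl (λ _ → refl) $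
  wait-⊓x-top _ 0 _ 20 refl refl $
  wait-⊓ _ (orL hole _) _ _ refl (entails λ M ρ _ k → k λ (¬⊤ , _) → ¬⊤ tt)
    (⊓⊔-query (Additive ∷ []) _ _ _ 20 22 refl refl refl $
     ⊔-choose _ (orR _ hole) _ _ true $
     ⊔x-choose _ (orR _ hole) 1 _ (var 22) (inj₂ (22 , refl , refl)) $
     wait-elementary _ _ refl (entails-∨ʳ x1≡[x0]′))
    (wait-⊓x _ (orL hole _) 1 _ 21 refl refl (entails λ M ρ _ k → k λ (¬⊤ , _) → ¬⊤ tt) $
     ⊓⊔-query (Additive ∷ []) _ _ _ 20 22 refl refl refl $
     ⊔-choose _ (orR _ hole) _ _ true $
     ⊔x-choose _ (orR _ hole) 1 _ (var 22) (inj₂ (22 , refl , refl)) $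
     wait-elementary _ _ refl (entails-∨ʳ x1≡[x0]′))
  where
  x1≡[x0]′ : ∀ M ρ → SatAnte M ρ (Additive ∷ Eq (var 22) (var 20 ·0) ∷ []) → _
  x1≡[x0]′ M ρ (_ , y≈x0) = (λ (¬eq , _) → ¬eq x1≈y′) , x1≈y′
    where
    open ClassicalEquality M
    x1≈y′ = ≈-cong (sc M) (≈-sym y≈x0)

⊢Predecessor : Provable (⊓closure Predecessor)
⊢Predecessor = induction Predecessor 0 Predecessor-bounded
  ⊢Predecessor-base ⊢Predecessor-step₀ ⊢Predecessor-step₁

-- Comparison: ⊓v (|v| ≤ |p| → ⊔z (x = v + z ⊔ v = x + z + 1)), by induction on x

SizeLe-refl : ∀ M ρ s → Sat M ρ (SizeLe s s)
SizeLe-refl M ρ s P = ⇒-intro M (update ρ 10 P) (PowerOf2 (var 10)) (Less s (var 10) ⇒ Less s (var 10)) refl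
  λ _ k → k (⇒-intro M (update ρ 10 P) (Less s (var 10)) (Less s (var 10)) refl λ s<P k′ → k′ s<P)

module _ (M : Structure) (laws : ClassicalEquality.AdditiveLaws M) where
  open ClassicalEquality M
  open AdditiveLaws laws

  Less-downward : ∀ ρ s s′ r d → inT 13 s ≡ false → inT 13 s′ ≡ false → inT 13 r ≡ false →
    pl M (evalT M ρ s′) d ≈ evalT M ρ s → Sat M ρ (Less s r) → Sat M ρ (Less s′ r)
  Less-downward ρ s s′ r d s∌13 s′∌13 r∌13 s′+d≈s s<r ¬s′<r = s<r λ w s+w′≈r →
    ¬s′<r (pl M d w) (≈-trans (≈-cong (λ a → pl M a (sc M (pl M d w))) (≈-reflexive (ρ′ (pl M d w) s′ s′∌13)))
      (≈-trans (+-suc _ _) (≈-trans (≈-cong (sc M) (≈-sym (+-assoc _ _ _)))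
      (≈-trans (≈-cong (λ a → sc M (pl M a w)) s′+d≈s) (≈-trans (≈-sym (+-suc _ _))
      (≈-trans (≈-cong (λ a → pl M a (sc M w)) (≈-reflexive (sym (ρ′ w s s∌13))))
      (≈-trans s+w′≈r (≈-reflexive (trans (ρ′ w r r∌13) (sym (ρ′ (pl M d w) r r∌13)))))))))))
    where
    ρ′ : ∀ w t → inT 13 t ≡ false → evalT M (update ρ 13 w) t ≡ evalT M ρ t
    ρ′ w t t∌13 = evalT-update M ρ 13 w t t∌13

  SizeLe-downward : ∀ ρ s s′ t d →
    inT 10 s ≡ false → inT 13 s ≡ false → inT 10 s′ ≡ false → inT 13 s′ ≡ false →
    pl M (evalT M ρ s′) d ≈ evalT M ρ s → Sat M ρ (SizeLe s t) → Sat M ρ (SizeLe s′ t)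
  SizeLe-downward ρ s s′ t d s∌10 s∌13 s′∌10 s′∌13 s′+d≈s |s|≤|t| P =
    ⇒-intro M ρ′ (PowerOf2 (var 10)) (Less t (var 10) ⇒ Less s′ (var 10)) refl λ pow k →
    ⇒-elim M ρ′ (PowerOf2 (var 10)) (Less t (var 10) ⇒ Less s (var 10)) refl (|s|≤|t| P) pow λ t<P⇒s<P →
    k (⇒-intro M ρ′ (Less t (var 10)) (Less s′ (var 10)) refl λ t<P k′ →
    ⇒-elim M ρ′ (Less t (var 10)) (Less s (var 10)) refl t<P⇒s<P t<P λ s<P →
    k′ (Less-downward ρ′ s s′ (var 10) d s∌13 s′∌13 refl
         (transport₂ (λ a b → pl M a d ≈ b) (sym (evalT-update M ρ 10 P s′ s′∌10)) (sym (evalT-update M ρ 10 P s s∌10))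
           s′+d≈s) s<P))
    where ρ′ = update ρ 10 P

⊢Comparison-base : Provable (⊓closure (subst 0 𝟎 Comparison))
⊢Comparison-base = consequence (⊢Additive ∷ ⊢Predecessor ∷ []) refl (λ _ → refl) $
  wait-⊓x-top _ 1 _ 20 refl refl $
  wait-⊓x-top _ 2 _ 21 refl refl $
  ⊓x-choose (Additive ∷ []) _ hole 0 _ (var 21) _ (inj₂ (21 , refl , refl)) $
  wait-⊔-top (Additive ∷ []) _ _ _ _ refl
    (⊔x-choose _ (orR _ hole) 3 _ 𝟎 (inj₁ refl) $
     ⊔-choose _ (orR _ (andR _ hole)) _ _ false $
     wait-elementary _ _ refl (entails-∨ʳ v≡0⇒0≡v+0))
    (wait-⊔x-top (Additive ∷ []) _ 1 _ _ 22 refl refl $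
     ⊔x-choose _ (orR _ hole) 3 _ (var 22) (inj₂ (22 , refl , refl)) $
     ⊔-choose _ (orR _ (andR _ hole)) _ _ true $
     wait-elementary _ _ refl (entails-∨ʳ v≡u′⇒v≡[0+u]′))
  where
  v≡0⇒0≡v+0 : ∀ M ρ → SatAnte M ρ (Additive ∷ Eq (var 21) 𝟎 ∷ []) → _
  v≡0⇒0≡v+0 M ρ (laws , v≈0) = (λ (¬eqs , _) → ¬eqs (λ (¬e , _) → ¬e 0≈v+0)) , 0≈v+0
    where
    open ClassicalEquality M
    open AdditiveLaws (additive-laws M ρ laws)
    0≈v+0 = ≈-sym (≈-trans (+-identityʳ _) v≈0)

  v≡u′⇒v≡[0+u]′ : ∀ M ρ → SatAnte M ρ (Additive ∷ subst 1 (var 22) (subst 0 (var 21) (And predecessor-bound x≡y′)) ∷ []) → _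
  v≡u′⇒v≡[0+u]′ M ρ (laws , _ , v≈u′) = (λ (¬eqs , _) → ¬eqs (λ (_ , ¬e) → ¬e v≈[0+u]′)) , v≈[0+u]′
    where
    open ClassicalEquality M
    open AdditiveLaws (additive-laws M ρ laws)
    v≈[0+u]′ = ≈-trans v≈u′ (≈-cong (sc M) (≈-sym (+-identityˡ _)))

-- Asking the induction hypothesis about w is legal only under |w| ≤ |p|, which follows from
-- |v| ≤ |p| unless the environment's v violates the bound. Stated on the Sets that the
-- elementarizations compute to, so that the remaining formulas are found by unification.
module _ (M : Structure) (ρ : Var → D M) (v p w : Term)
         (w-bound : Sat M ρ (SizeLe v p) → Sat M ρ (SizeLe w p)) where

  IH-asked : ∀ {X : Set} → X →
    ¬ ¬ ¬ (¬ (Sat M ρ (SizeLe w p) × X) × ¬ ¬ (¬ Sat M ρ (neg (SizeLe v p)) × ¬ ⊥))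
  IH-asked x k = k λ (¬asked , ¬ours) → ¬ours λ (¬¬v-bound , _) →
    ¬asked (w-bound (sat-by-¬neg M (SizeLe v p) ρ refl ¬¬v-bound) , x)

  IH-answered : ∀ {X N S H : Set} → (¬ N → H) → (H → S) →
    ¬ ¬ ¬ (¬ (Sat M ρ (SizeLe w p) × ¬ (¬ X × ¬ N)) × ¬ ¬ (¬ Sat M ρ (neg (SizeLe v p)) × ¬ (S × H)))
  IH-answered answer bound k = k λ (¬asked , ¬ours) → ¬ours λ (¬¬v-bound , ¬ans) →
    ¬asked (w-bound (sat-by-¬neg M (SizeLe v p) ρ refl ¬¬v-bound) ,
            λ (_ , ¬N) → ¬ans (bound (answer ¬N) , answer ¬N))

-- Variables of the induction steps: x = var 20, p = var 21, v = var 22, w = var 23 with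
-- v = w0 or v = w1; the answers z of the induction hypothesis and our z′ come after.
module StepArithmetic (M : Structure) (ρ : Var → D M) (laws : Sat M ρ Additive) where
  open ClassicalEquality M
  open AdditiveLaws (additive-laws M ρ laws)
  open Linear (additive-laws M ρ laws) ρ
  open ≈-Reasoning

  infix 4 _≐_
  _≐_ : Term → Term → Set
  s ≐ t = Sat M ρ (Eq s t)

  ev : Term → D M
  ev = evalT M ρ

  x p v w : Term
  x = var 20
  p = var 21
  v = var 22
  w = var 23

  private
    dbl : D M → D M
    dbl = tm M (sc M (sc M (z M)))

    downward : ∀ s′ d → pl M (ev s′) d ≈ ev v → inT 10 s′ ≡ false → inT 13 s′ ≡ false →
      Sat M ρ (SizeLe v p) → Sat M ρ (SizeLe s′ p)
    downward s′ d s′+d≈v s′∌10 s′∌13 =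
      SizeLe-downward M (additive-laws M ρ laws) ρ v s′ p d refl refl s′∌10 s′∌13 s′+d≈v

  w0-bound : v ≐ w ·0 → Sat M ρ (SizeLe v p) → Sat M ρ (SizeLe w p)
  w0-bound v≈w0 = downward w (ρ 23) (≈-trans (≈-sym (2*-double _)) (≈-sym v≈w0)) refl refl

  w1-bound : v ≐ w ·1 → Sat M ρ (SizeLe v p) → Sat M ρ (SizeLe w p)
  w1-bound v≈w1 = downward w (sc M (ρ 23)) (≈-trans (solve (w ⊕ w ′) (w ·0 ′) refl refl) (≈-sym v≈w1)) refl refl

  w1-bound′ : v ≐ w ·1 → var 24 ≐ w ′ → Sat M ρ (SizeLe v p) → Sat M ρ (SizeLe (var 24) p)
  w1-bound′ v≈w1 w⁺≈w′ = downward (var 24) (ρ 23) (begin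
    ev (var 24 ⊕ w)  ≈⟨ ≈-cong (λ a → pl M a (ρ 23)) w⁺≈w′ ⟩
    ev (w ′ ⊕ w)     ≈⟨ solve (w ′ ⊕ w) (w ·0 ′) refl refl ⟩
    ev (w ·0 ′)      ≈⟨ ≈-sym v≈w1 ⟩
    ev v             ∎) refl refl

  x0-even-sub : v ≐ w ·0 → var 25 ≐ var 24 ·0 → x ≐ w ⊕ var 24 → x ·0 ≐ v ⊕ var 25
  x0-even-sub v≈w0 z′≈z0 x≈w+z = begin
    ev (x ·0)               ≈⟨ ≈-cong dbl x≈w+z ⟩
    ev ((w ⊕ var 24) ·0)    ≈⟨ solve ((w ⊕ var 24) ·0) (w ·0 ⊕ var 24 ·0) refl refl ⟩
    ev (w ·0 ⊕ var 24 ·0)   ≈⟨ ≈-cong₂ (pl M) (≈-sym v≈w0) (≈-sym z′≈z0) ⟩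
    ev (v ⊕ var 25)         ∎

  x0-even-sup : v ≐ w ·0 → var 25 ≐ var 24 ·0 → var 26 ≐ var 25 ′ →
                w ≐ (x ⊕ var 24) ′ → v ≐ (x ·0 ⊕ var 26) ′
  x0-even-sup v≈w0 z₀≈z0 z′≈z₀′ w≈[x+z]′ = begin
    ev v                          ≈⟨ v≈w0 ⟩
    ev (w ·0)                     ≈⟨ ≈-cong dbl w≈[x+z]′ ⟩
    ev (((x ⊕ var 24) ′) ·0)        ≈⟨ solve (((x ⊕ var 24) ′) ·0) ((x ·0 ⊕ var 24 ·0 ′) ′) refl refl ⟩
    ev ((x ·0 ⊕ var 24 ·0 ′) ′)   ≈⟨ ≈-cong (λ a → sc M (pl M (dbl (ρ 20)) a))
                                      (≈-trans (≈-cong (sc M) (≈-sym z₀≈z0)) (≈-sym z′≈z₀′)) ⟩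
    ev ((x ·0 ⊕ var 26) ′)        ∎

  x0-odd-sub : v ≐ w ·1 → var 24 ≐ w ′ → var 26 ≐ var 25 ·0 → var 27 ≐ var 26 ′ →
               x ≐ var 24 ⊕ var 25 → x ·0 ≐ v ⊕ var 27
  x0-odd-sub v≈w1 w⁺≈w′ z₀≈z0 z′≈z₀′ x≈w⁺+z = begin
    ev (x ·0)                  ≈⟨ ≈-cong dbl x≈w⁺+z ⟩
    ev ((var 24 ⊕ var 25) ·0)  ≈⟨ ≈-cong (λ a → dbl (pl M a (ρ 25))) w⁺≈w′ ⟩
    ev ((w ′ ⊕ var 25) ·0)     ≈⟨ solve ((w ′ ⊕ var 25) ·0) (w ·1 ⊕ var 25 ·0 ′) refl refl ⟩
    ev (w ·1 ⊕ var 25 ·0 ′)    ≈⟨ ≈-cong₂ (pl M) (≈-sym v≈w1) (≈-trans (≈-cong (sc M) (≈-sym z₀≈z0)) (≈-sym z′≈z₀′)) ⟩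
    ev (v ⊕ var 27)            ∎

  x0-odd-sup : v ≐ w ·1 → var 24 ≐ w ′ → var 26 ≐ var 25 ·0 →
               var 24 ≐ (x ⊕ var 25) ′ → v ≐ (x ·0 ⊕ var 26) ′
  x0-odd-sup v≈w1 w⁺≈w′ z′≈z0 w⁺≈[x+z]′ = begin
    ev v                        ≈⟨ v≈w1 ⟩
    ev (w ·1)                   ≈⟨ ≈-cong (λ a → sc M (dbl a)) (suc-injective _ _ (≈-trans (≈-sym w⁺≈w′) w⁺≈[x+z]′)) ⟩
    ev ((x ⊕ var 25) ·1)        ≈⟨ solve ((x ⊕ var 25) ·1) ((x ·0 ⊕ var 25 ·0) ′) refl refl ⟩
    ev ((x ·0 ⊕ var 25 ·0) ′)   ≈⟨ ≈-cong (λ a → sc M (pl M (dbl (ρ 20)) a)) (≈-sym z′≈z0) ⟩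
    ev ((x ·0 ⊕ var 26) ′)      ∎

  x1-even-sub : v ≐ w ·0 → var 25 ≐ var 24 ·0 → var 26 ≐ var 25 ′ →
                x ≐ w ⊕ var 24 → x ·1 ≐ v ⊕ var 26
  x1-even-sub v≈w0 z₀≈z0 z′≈z₀′ x≈w+z = begin
    ev (x ·1)                 ≈⟨ ≈-cong (λ a → sc M (dbl a)) x≈w+z ⟩
    ev ((w ⊕ var 24) ·1)      ≈⟨ solve ((w ⊕ var 24) ·1) (w ·0 ⊕ var 24 ·0 ′) refl refl ⟩
    ev (w ·0 ⊕ var 24 ·0 ′)   ≈⟨ ≈-cong₂ (pl M) (≈-sym v≈w0) (≈-trans (≈-cong (sc M) (≈-sym z₀≈z0)) (≈-sym z′≈z₀′)) ⟩
    ev (v ⊕ var 26)           ∎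

  x1-even-sup : v ≐ w ·0 → var 25 ≐ var 24 ·0 → w ≐ (x ⊕ var 24) ′ → v ≐ (x ·1 ⊕ var 25) ′
  x1-even-sup v≈w0 z′≈z0 w≈[x+z]′ = begin
    ev v                        ≈⟨ v≈w0 ⟩
    ev (w ·0)                   ≈⟨ ≈-cong dbl w≈[x+z]′ ⟩
    ev (((x ⊕ var 24) ′) ·0)      ≈⟨ solve (((x ⊕ var 24) ′) ·0) ((x ·1 ⊕ var 24 ·0) ′) refl refl ⟩
    ev ((x ·1 ⊕ var 24 ·0) ′)   ≈⟨ ≈-cong (λ a → sc M (pl M (sc M (dbl (ρ 20))) a)) (≈-sym z′≈z0) ⟩
    ev ((x ·1 ⊕ var 25) ′)      ∎

  x1-odd-sub : v ≐ w ·1 → var 25 ≐ var 24 ·0 → x ≐ w ⊕ var 24 → x ·1 ≐ v ⊕ var 25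
  x1-odd-sub v≈w1 z′≈z0 x≈w+z = begin
    ev (x ·1)               ≈⟨ ≈-cong (λ a → sc M (dbl a)) x≈w+z ⟩
    ev ((w ⊕ var 24) ·1)    ≈⟨ solve ((w ⊕ var 24) ·1) (w ·1 ⊕ var 24 ·0) refl refl ⟩
    ev (w ·1 ⊕ var 24 ·0)   ≈⟨ ≈-cong₂ (pl M) (≈-sym v≈w1) (≈-sym z′≈z0) ⟩
    ev (v ⊕ var 25)         ∎

  x1-odd-sup : v ≐ w ·1 → var 25 ≐ var 24 ·0 → var 26 ≐ var 25 ′ →
               w ≐ (x ⊕ var 24) ′ → v ≐ (x ·1 ⊕ var 26) ′
  x1-odd-sup v≈w1 z₀≈z0 z′≈z₀′ w≈[x+z]′ = begin
    ev v                          ≈⟨ v≈w1 ⟩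
    ev (w ·1)                     ≈⟨ ≈-cong (λ a → sc M (dbl a)) w≈[x+z]′ ⟩
    ev (((x ⊕ var 24) ′) ·1)        ≈⟨ solve (((x ⊕ var 24) ′) ·1) ((x ·1 ⊕ var 24 ·0 ′) ′) refl refl ⟩
    ev ((x ·1 ⊕ var 24 ·0 ′) ′)   ≈⟨ ≈-cong (λ a → sc M (pl M (sc M (dbl (ρ 20))) a))
                                      (≈-trans (≈-cong (sc M) (≈-sym z₀≈z0)) (≈-sym z′≈z₀′)) ⟩
    ev ((x ·1 ⊕ var 26) ′)        ∎

bound-by-left : ∀ {A B C : Set} → A → ¬ (¬ ¬ (¬ A × B) × C)
bound-by-left a (¬eqs , _) = ¬eqs λ (¬a , _) → ¬a a

bound-by-right : ∀ {A B C : Set} → B → ¬ (¬ ¬ (A × ¬ B) × C)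
bound-by-right b (¬eqs , _) = ¬eqs λ (_ , ¬b) → ¬b b

⊢Comparison-step₀ : Provable (⊓closure (Comparison ⇒ subst 0 (var 0 ·0) Comparison))
⊢Comparison-step₀ = consequence (⊢Additive ∷ ⊢Halving ∷ ⊢Doubling ∷ ⊢Successor ∷ ⊢Successor ∷ []) refl (λ _ → refl) $
  wait-⊓x-top _ 0 _ 20 refl refl $
  wait-⊓x-top _ 1 _ 21 refl refl $
  wait-⊓x _ (orR _ hole) 2 _ 22 refl refl (entails λ M ρ _ k → k λ (_ , ¬⊤) → ¬⊤ tt) $
  ⊓⊔-query (Additive ∷ []) _ _ _ 22 23 refl refl refl $
  wait-⊔ (Additive ∷ []) _ (andR _ hole) _ _ _ refl (entails λ { M ρ (_ , (_ , ()) , _) })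
    (⊔x-choose _ (orL hole _) 2 _ (var 23) (inj₂ (23 , refl , refl)) $
     wait-⊓x _ (orL (andR _ hole) _) 3 _ 24 refl refl
       (entails λ M ρ (laws , (_ , v≈w0) , _) → let open StepArithmetic M ρ laws in
         IH-asked M ρ v p w (w0-bound v≈w0) tt) $
     wait-⊓ _ (orL (andR _ (orR _ hole)) _) _ _ refl
       (entails λ M ρ (laws , (_ , v≈w0) , _) → let open StepArithmetic M ρ laws in
         IH-asked M ρ v p w (w0-bound v≈w0) λ (_ , ¬⊤) → ¬⊤ tt)
       (⊓⊔-query (Additive ∷ _ ∷ []) _ _ _ 24 25 refl refl refl $
        ⊔x-choose _ (orR _ (orR _ hole)) 3 _ (var 25) (inj₂ (25 , refl , refl)) $
        ⊔-choose _ (orR _ (orR _ (andR _ hole))) _ _ false $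
        wait-elementary _ _ refl $ entails λ M ρ (laws , (_ , v≈w0) , z′≈z0 , _) →
          let open StepArithmetic M ρ laws in
          IH-answered M ρ v p w (w0-bound v≈w0) (x0-even-sub v≈w0 z′≈z0) bound-by-left)
       (⊓⊔-query (Additive ∷ _ ∷ []) _ _ _ 24 25 refl refl refl $
        ⊓⊔-query (Additive ∷ _ ∷ _ ∷ []) _ _ _ 25 26 refl refl refl $
        ⊔x-choose _ (orR _ (orR _ hole)) 3 _ (var 26) (inj₂ (26 , refl , refl)) $
        ⊔-choose _ (orR _ (orR _ (andR _ hole))) _ _ true $
        wait-elementary _ _ refl $ entails λ M ρ (laws , (_ , v≈w0) , z₀≈z0 , z′≈z₀′ , _) →
          let open StepArithmetic M ρ laws in
          IH-answered M ρ v p w (w0-bound v≈w0) (x0-even-sup v≈w0 z₀≈z0 z′≈z₀′) bound-by-right))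
    (⊓⊔-query (Additive ∷ _ ∷ Doubling ∷ []) _ _ _ 23 24 refl refl refl $
     ⊔x-choose _ (orL hole _) 2 _ (var 24) (inj₂ (24 , refl , refl)) $
     wait-⊓x _ (orL (andR _ hole) _) 3 _ 25 refl refl
       (entails λ M ρ (laws , (_ , v≈w1) , _ , w⁺≈w′ , _) → let open StepArithmetic M ρ laws in
         IH-asked M ρ v p (var 24) (w1-bound′ v≈w1 w⁺≈w′) tt) $
     wait-⊓ _ (orL (andR _ (orR _ hole)) _) _ _ refl
       (entails λ M ρ (laws , (_ , v≈w1) , _ , w⁺≈w′ , _) → let open StepArithmetic M ρ laws in
         IH-asked M ρ v p (var 24) (w1-bound′ v≈w1 w⁺≈w′) λ (_ , ¬⊤) → ¬⊤ tt)
       (⊓⊔-query (Additive ∷ _ ∷ []) _ _ _ 25 26 refl refl refl $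
        ⊓⊔-query (Additive ∷ _ ∷ _ ∷ _ ∷ []) _ _ _ 26 27 refl refl refl $
        ⊔x-choose _ (orR _ (orR _ hole)) 3 _ (var 27) (inj₂ (27 , refl , refl)) $
        ⊔-choose _ (orR _ (orR _ (andR _ hole))) _ _ false $
        wait-elementary _ _ refl $ entails λ M ρ (laws , (_ , v≈w1) , z₀≈z0 , w⁺≈w′ , z′≈z₀′) →
          let open StepArithmetic M ρ laws in
          IH-answered M ρ v p (var 24) (w1-bound′ v≈w1 w⁺≈w′)
            (x0-odd-sub v≈w1 w⁺≈w′ z₀≈z0 z′≈z₀′) bound-by-left)
       (⊓⊔-query (Additive ∷ _ ∷ []) _ _ _ 25 26 refl refl refl $
        ⊔x-choose _ (orR _ (orR _ hole)) 3 _ (var 26) (inj₂ (26 , refl , refl)) $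
        ⊔-choose _ (orR _ (orR _ (andR _ hole))) _ _ true $
        wait-elementary _ _ refl $ entails λ M ρ (laws , (_ , v≈w1) , z′≈z0 , w⁺≈w′ , _) →
          let open StepArithmetic M ρ laws in
          IH-answered M ρ v p (var 24) (w1-bound′ v≈w1 w⁺≈w′)
            (x0-odd-sup v≈w1 w⁺≈w′ z′≈z0) bound-by-right))

⊢Comparison-step₁ : Provable (⊓closure (Comparison ⇒ subst 0 (var 0 ·1) Comparison))
⊢Comparison-step₁ = consequence (⊢Additive ∷ ⊢Halving ∷ ⊢Doubling ∷ ⊢Successor ∷ []) refl (λ _ → refl) $
  wait-⊓x-top _ 0 _ 20 refl refl $
  wait-⊓x-top _ 1 _ 21 refl refl $
  wait-⊓x _ (orR _ hole) 2 _ 22 refl refl (entails λ M ρ _ k → k λ (_ , ¬⊤) → ¬⊤ tt) $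
  ⊓⊔-query (Additive ∷ []) _ _ _ 22 23 refl refl refl $
  wait-⊔ (Additive ∷ []) _ (andR _ hole) _ _ _ refl (entails λ { M ρ (_ , (_ , ()) , _) })
    (⊔x-choose _ (orL hole _) 2 _ (var 23) (inj₂ (23 , refl , refl)) $
     wait-⊓x _ (orL (andR _ hole) _) 3 _ 24 refl refl
       (entails λ M ρ (laws , (_ , v≈w0) , _) → let open StepArithmetic M ρ laws in
         IH-asked M ρ v p w (w0-bound v≈w0) tt) $
     wait-⊓ _ (orL (andR _ (orR _ hole)) _) _ _ refl
       (entails λ M ρ (laws , (_ , v≈w0) , _) → let open StepArithmetic M ρ laws in
         IH-asked M ρ v p w (w0-bound v≈w0) λ (_ , ¬⊤) → ¬⊤ tt)
       (⊓⊔-query (Additive ∷ _ ∷ []) _ _ _ 24 25 refl refl refl $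
        ⊓⊔-query (Additive ∷ _ ∷ _ ∷ []) _ _ _ 25 26 refl refl refl $
        ⊔x-choose _ (orR _ (orR _ hole)) 3 _ (var 26) (inj₂ (26 , refl , refl)) $
        ⊔-choose _ (orR _ (orR _ (andR _ hole))) _ _ false $
        wait-elementary _ _ refl $ entails λ M ρ (laws , (_ , v≈w0) , z₀≈z0 , z′≈z₀′) →
          let open StepArithmetic M ρ laws in
          IH-answered M ρ v p w (w0-bound v≈w0) (x1-even-sub v≈w0 z₀≈z0 z′≈z₀′) bound-by-left)
       (⊓⊔-query (Additive ∷ _ ∷ []) _ _ _ 24 25 refl refl refl $
        ⊔x-choose _ (orR _ (orR _ hole)) 3 _ (var 25) (inj₂ (25 , refl , refl)) $
        ⊔-choose _ (orR _ (orR _ (andR _ hole))) _ _ true $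
        wait-elementary _ _ refl $ entails λ M ρ (laws , (_ , v≈w0) , z′≈z0 , _) →
          let open StepArithmetic M ρ laws in
          IH-answered M ρ v p w (w0-bound v≈w0) (x1-even-sup v≈w0 z′≈z0) bound-by-right))
    (⊔x-choose _ (orL hole _) 2 _ (var 23) (inj₂ (23 , refl , refl)) $
     wait-⊓x _ (orL (andR _ hole) _) 3 _ 24 refl refl
       (entails λ M ρ (laws , (_ , v≈w1) , _) → let open StepArithmetic M ρ laws in
         IH-asked M ρ v p w (w1-bound v≈w1) tt) $
     wait-⊓ _ (orL (andR _ (orR _ hole)) _) _ _ refl
       (entails λ M ρ (laws , (_ , v≈w1) , _) → let open StepArithmetic M ρ laws in
         IH-asked M ρ v p w (w1-bound v≈w1) λ (_ , ¬⊤) → ¬⊤ tt)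
       (⊓⊔-query (Additive ∷ _ ∷ []) _ _ _ 24 25 refl refl refl $
        ⊔x-choose _ (orR _ (orR _ hole)) 3 _ (var 25) (inj₂ (25 , refl , refl)) $
        ⊔-choose _ (orR _ (orR _ (andR _ hole))) _ _ false $
        wait-elementary _ _ refl $ entails λ M ρ (laws , (_ , v≈w1) , z′≈z0 , _) →
          let open StepArithmetic M ρ laws in
          IH-answered M ρ v p w (w1-bound v≈w1) (x1-odd-sub v≈w1 z′≈z0) bound-by-left)
       (⊓⊔-query (Additive ∷ _ ∷ []) _ _ _ 24 25 refl refl refl $
        ⊓⊔-query (Additive ∷ _ ∷ _ ∷ []) _ _ _ 25 26 refl refl refl $
        ⊔x-choose _ (orR _ (orR _ hole)) 3 _ (var 26) (inj₂ (26 , refl , refl)) $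
        ⊔-choose _ (orR _ (orR _ (andR _ hole))) _ _ true $
        wait-elementary _ _ refl $ entails λ M ρ (laws , (_ , v≈w1) , z₀≈z0 , z′≈z₀′) →
          let open StepArithmetic M ρ laws in
          IH-answered M ρ v p w (w1-bound v≈w1) (x1-odd-sup v≈w1 z₀≈z0 z′≈z₀′) bound-by-right))

⊢Comparison : Provable (⊓closure Comparison)
⊢Comparison = induction Comparison 0 Comparison-bounded
  ⊢Comparison-base ⊢Comparison-step₀ ⊢Comparison-step₁

p-within-own-size : ∀ M ρ → ¬ Sat M ρ (neg (SizeLe (var 21) (var 21)))
p-within-own-size M ρ = sat-neg-⊥ M (SizeLe (var 21) (var 21)) ρ refl (SizeLe-refl M ρ (var 21))

-- Compare x with v := y under the parameter p := y; an answer y = x + z + 1 becomes y = x + z′.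
fact12p7 : Provable (CForall 0 (CForall 1 (CExists 2
    (COr (Eq (var 0) (var 1 ⊕ var 2)) (Eq (var 1) (var 0 ⊕ var 2))))))
fact12p7 = consequence (⊢Additive ∷ ⊢Comparison ∷ ⊢Successor ∷ []) refl (λ _ → refl) $
  wait-⊓x-top _ 0 _ 20 refl refl $
  wait-⊓x-top _ 1 _ 21 refl refl $
  ⊓x-choose (Additive ∷ []) _ hole 0 _ (var 20) _ (inj₂ (20 , refl , refl)) $
  ⊓x-choose (Additive ∷ []) _ hole 1 _ (var 21) _ (inj₂ (21 , refl , refl)) $
  ⊓x-choose (Additive ∷ []) _ hole 2 _ (var 21) _ (inj₂ (21 , refl , refl)) $
  wait-⊔x (Additive ∷ []) _ (orR _ hole) 3 _ _ 22 refl refl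
    (entails λ M ρ (_ , ans , _) _ → ans (p-within-own-size M ρ , λ ())) $
  wait-⊔ (Additive ∷ []) _ (orR _ (andR _ hole)) _ _ _ refl
    (entails λ M ρ (_ , ans , _) _ → ans (p-within-own-size M ρ , λ ()))
    (⊔x-choose _ hole 2 _ (var 22) (inj₂ (22 , refl , refl)) $
     ⊔-choose _ hole _ _ false $
     wait-elementary _ _ refl $ entails λ M ρ (_ , ans , _) k →
       ans (p-within-own-size M ρ , λ (_ , x≈y+z) → k x≈y+z))
    (⊓⊔-query (Additive ∷ _ ∷ []) _ _ _ 22 23 refl refl refl $
     ⊔x-choose _ hole 2 _ (var 23) (inj₂ (23 , refl , refl)) $
     ⊔-choose _ hole _ _ true $
     wait-elementary _ _ refl $ entails λ M ρ (laws , ans , z′≈z+1) k →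
       let open ClassicalEquality M
           open AdditiveLaws (additive-laws M ρ laws)
       in ans (p-within-own-size M ρ , λ (_ , y≈[x+z]′) →
            k (≈-trans y≈[x+z]′ (≈-trans (≈-sym (+-suc _ _)) (≈-cong (pl M (ρ 20)) (≈-sym z′≈z+1))))))
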